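{- Let $r\geq 3$ and $k$ be positive integers with $k> \frac{2r^2-r-2}{2}$, and let $G$ be the graph $G(k,r)$ constructed as follows. First, let $G_1$ be the bipartite graph with bipartition $\{A\cup D,\ B\cup C\}$ defined by: $|A|=k$; $B$ is the disjoint union of sets $B_S$, one for each nonempty subset $S\subseteq A$, with $|B_S|=k(k+r)+1$, and every vertex of $B_S$ is adjacent exactly to the vertices of $S$; $C$ has $(k+r+1)k^2$ vertices, each adjacent to all vertices of $A$; $C$ is partitioned into $(k+r+1)k$ disjoint $k$-subsets, and $D$ has $(k+r+1)k$ vertices, each adjacent to exactly the vertices of a distinct one of these $k$-subsets of $C$. There are no other edges. Take $r$ disjoint copies $G_1,\dots,G_r$ of this graph, and denote by $A_s,B_s,C_s,D_s$ the sets $A,B,C,D$ of the copy $G_s$ ($1\leq s\leq r$). For each $s$ choose a subset $U_s\subseteq A_s$ with $|U_s|=\lfloor \frac{2k}{r-1}\rfloor$, and add all edges between $U_i$ and $U_j$ for all $i\neq j$. The resulting graph is $G$. Then $\left\lceil \frac{\text{Mad}(G)}{2} \right\rceil = k$ and $\vec{\chi}(G)\geq k+r+1$.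
   Context: Graphs are finite and simple. A proper orientation $D$ of a graph $G$ is an orientation of the edges of $G$ such that $d_D^+(u)\neq d_D^+(v)$ for every edge $uv\in E(G)$, where $d_D^+$ denotes out-degree in $D$. The proper orientation number $\vec{\chi}(G)$ is the minimum of $\Delta^+(D)$ (the maximum out-degree of $D$) over all proper orientations $D$ of $G$. The maximum average degree is $\text{Mad}(G)=\max_{H\subseteq G} \frac{2|E(H)|}{|V(H)|}$, the maximum over all (nonempty) subgraphs $H$ of $G$. -}

module Defs where

open import Data.Bool using (Bool; true; false; _∧_; _∨_; not; if_then_else_)
open import Data.Nat as ℕ using (ℕ; zero; suc; _+_; _*_; _∸_; _^_; _⊔_; _%_; _/_; _≡ᵇ_; NonZero)
open import Data.Fin as Fin using (Fin; toℕ; splitAt; remQuot)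
open import Data.Fin.Subset using (Subset)
open import Data.Vec using (Vec; []; _∷_; lookup)
open import Data.List using (List; map; foldr; allFin)
open import Data.Nat.ListAction using (sum)
open import Data.Product using (Σ; _×_; _,_; ∃)
open import Data.Sum using (_⊎_; inj₁; inj₂)
open import Data.Integer using (ℤ; +_)
open import Data.Rational as ℚ using (ℚ)
open import Relation.Nullary using (does; ¬_)
open import Relation.Binary.PropositionalEquality using (_≡_; _≢_)

-- Finite simple graphs on vertex set Fin n, adjacency given as a
-- Boolean-valued relation (symmetric and irreflexive for the graphs
-- considered below).

record Graph : Set where
  field
    n   : ℕ
    adj : Fin n → Fin n → Bool
open Graph public

countF : {n : ℕ} → (Fin n → Bool) → ℕ
countF {n} p = sum (map (λ i → if p i then 1 else 0) (allFin n))

record Subgraph (G : Graph) : Set where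
  field
    inV    : Fin (n G) → Bool
    inE    : Fin (n G) → Fin (n G) → Bool
    inE-sym : ∀ u v → inE u v ≡ inE v u
    inE-adj : ∀ u v → inE u v ≡ true → adj G u v ≡ true
    inE-inV : ∀ u v → inE u v ≡ true → inV u ≡ true
open Subgraph public

∣V∣ : {G : Graph} → Subgraph G → ℕ
∣V∣ H = countF (inV H)

∣E∣ : {G : Graph} → Subgraph G → ℕ
∣E∣ H = sum (map (λ u → countF (inE H u)) (allFin _)) / 2

avgDeg : {G : Graph} (H : Subgraph G) → .{{NonZero (∣V∣ H)}} → ℚ
avgDeg H = (+ (2 * ∣E∣ H)) ℚ./ ∣V∣ H

IsMad : Graph → ℚ → Set
IsMad G m =
  (Σ (Subgraph G) λ H → Σ (NonZero (∣V∣ H)) λ nz → avgDeg H {{nz}} ≡ m)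
  × (∀ (H : Subgraph G) (nz : NonZero (∣V∣ H)) → avgDeg H {{nz}} ℚ.≤ m)

record Orientation (G : Graph) : Set where
  field
    arc     : Fin (n G) → Fin (n G) → Bool
    arc-adj : ∀ u v → arc u v ≡ true → adj G u v ≡ true
    orient  : ∀ u v → adj G u v ≡ true →
              (arc u v ≡ true × arc v u ≡ false) ⊎ (arc u v ≡ false × arc v u ≡ true)
open Orientation public

outdeg : {G : Graph} → Orientation G → Fin (n G) → ℕ
outdeg D u = countF (arc D u)

Δ⁺ : {G : Graph} → Orientation G → ℕ
Δ⁺ {G} D = foldr _⊔_ 0 (map (outdeg D) (allFin (n G)))

Proper : {G : Graph} → Orientation G → Set
Proper {G} D = ∀ u v → adj G u v ≡ true → outdeg D u ≢ outdeg D v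

-- χ⃗(G) ≥ t, i.e. min over proper orientations D of Δ⁺(D) is ≥ t
PONAtLeast : Graph → ℕ → Set
PONAtLeast G t = ∀ (D : Orientation G) → Proper D → t ℕ.≤ Δ⁺ D

_=ᶠ_ : {m : ℕ} → Fin m → Fin m → Bool
i =ᶠ j = does (i Fin.≟ j)

-- binary digits (least significant first) of x, as a subset of Fin k
bits : ℕ → (k : ℕ) → Subset k
bits x zero    = []
bits x (suc k) = (x % 2 ≡ᵇ 1) ∷ bits (x / 2) k

-- the nonempty subsets S ⊆ A = Fin k are indexed by S : Fin (2^k ∸ 1),
-- S ↦ the subset whose characteristic binary number is toℕ S + 1
subsetOf : {k : ℕ} → Fin (2 ^ k ∸ 1) → Subset k
subsetOf {k} S = bits (suc (toℕ S)) k

module _ (k r : ℕ) where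
  nBlocks : ℕ
  nBlocks = (k + r + 1) * k
  sizeBS : ℕ
  sizeBS = k * (k + r) + 1

  -- vertices of one copy G_1 of the basic graph
  data Role : Set where
    roleA : Fin k → Role
    roleB : Fin (2 ^ k ∸ 1) → Fin sizeBS → Role
    roleC : Fin nBlocks → Fin k → Role                -- t-th vertex of i-th block of C
    roleD : Fin nBlocks → Role                        -- vertex of D attached to block i

  N₁ : ℕ
  N₁ = k + ((2 ^ k ∸ 1) * sizeBS + (nBlocks * k + nBlocks))

  decodeRole : Fin N₁ → Role
  decodeRole w with splitAt k w
  ... | inj₁ a = roleA a
  ... | inj₂ w₁ with splitAt ((2 ^ k ∸ 1) * sizeBS) w₁
  ...   | inj₁ b = let (S , j) = remQuot sizeBS b in roleB S j
  ...   | inj₂ w₂ with splitAt (nBlocks * k) w₂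
  ...     | inj₁ c = let (i , t) = remQuot k c in roleC i t
  ...     | inj₂ d = roleD d

  -- vertex set of G: copy index s ∈ Fin r and a vertex of the copy G_s
  decode : Fin (r * N₁) → Fin r × Role
  decode v = let (s , w) = remQuot N₁ v in s , decodeRole w

  adjR : (Fin r → Subset k) → Fin r × Role → Fin r × Role → Bool
  adjR U (s , roleA x)   (s' , roleA y)    = not (s =ᶠ s') ∧ (lookup (U s) x ∧ lookup (U s') y)
  adjR U (s , roleA x)   (s' , roleB S j)  = (s =ᶠ s') ∧ lookup (subsetOf S) x
  adjR U (s , roleB S j) (s' , roleA x)    = (s =ᶠ s') ∧ lookup (subsetOf S) x
  adjR U (s , roleA x)   (s' , roleC i t)  = s =ᶠ s'
  adjR U (s , roleC i t) (s' , roleA x)    = s =ᶠ s'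
  adjR U (s , roleC i t) (s' , roleD i')   = (s =ᶠ s') ∧ (i =ᶠ i')
  adjR U (s , roleD i')  (s' , roleC i t)  = (s =ᶠ s') ∧ (i =ᶠ i')
  adjR U _ _ = false

  Gkr : (Fin r → Subset k) → Graph
  Gkr U = record { n = r * N₁ ; adj = λ u v → adjR U (decode u) (decode v) }

  -- ⌊2k/(r-1)⌋  (written with divisor suc (r ∸ 2), which equals r - 1 for r ≥ 2)
  uSize : ℕ
  uSize = (2 * k) / suc (r ∸ 2)

-- Mad(G) ≤ 2k by discharging: every edge gives its two units of charge to its endpoint in
-- B ∪ C ∪ D, or one to each end if it joins two sets U_s, and then every vertex receives at
-- most 2k (a vertex of U_s has (r - 1)⌊2k/(r - 1)⌋ ≤ 2k neighbours in the other U_s′). The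
-- subgraph on A_s ∪ C_s is K_{k,(k+r+1)k}, of average degree > 2(k - 1). Hence ⌈Mad(G)/2⌉ = k.
--
-- Let D be a proper orientation with Δ⁺(D) ≤ k + r, and a ∈ A_s. If d⁺(a) ∈ [1, k], pick
-- S ∋ a with |S| = d⁺(a); as |B_S| > k(k + r), some b ∈ B_S receives no arc, so d⁺(b) = |S|.
-- If d⁺(a) = k + 1, some k-block of C_s receives no arc from A_s, as there are more than
-- k(k + r) blocks; its vertices c have d⁺(c) = k + [c → d] for the vertex d of D attached to
-- the block, and d⁺(d) = k if no c → d. So the out-degrees on U = ⋃ U_s avoid [1, k + 1], and
-- each value is taken inside a single U_s, as the U_s are pairwise completely joined. Counting
-- the r(r - 1)u²/2 edges inside U by their tails gives r(r - 1)u² ≤ u(r - 1)(2k + r + 2) for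
-- u = ⌊2k/(r - 1)⌋, which contradicts 2k > 2r² - r - 2.

module Submission where

open import Defs
open import Data.Bool using (Bool; true; false; T; if_then_else_; _∧_; _∨_; not)
open import Data.Bool.Properties using (∧-comm; ∧-conicalˡ; ∧-conicalʳ; ∧-zeroʳ)
open import Data.Empty using (⊥; ⊥-elim)
open import Data.Fin as Fin using (Fin; zero; suc; toℕ; fromℕ<; _↑ˡ_; _↑ʳ_; combine)
open import Data.Fin.Properties as Fin
  using (toℕ-fromℕ<; toℕ-injective; toℕ-↑ˡ; toℕ-↑ʳ; toℕ<n; remQuot-combine; splitAt-↑ˡ; splitAt-↑ʳ)
open import Data.Fin.Subset using (Subset; ∣_∣; ⊤) renaming (⊥ to ∅)
open import Data.Fin.Subset.Properties using (∣⊤∣≡n; ∣⊥∣≡0)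
open import Data.Integer as ℤ using (ℤ; +_; -[1+_]; +[1+_]) renaming (suc to sucℤ)
import Data.Integer.Properties as ℤ
open import Data.Integer.DivMod using (div-pos-is-/ℕ; [n/ℕd]*d≤n; n<s[n/ℕd]*d)
open import Data.Integer.GCD using (gcd)
open import Data.List as List using (allFin; tabulate)
open import Data.List.Properties using (map-tabulate)
open import Data.Nat
  using (ℕ; zero; suc; _+_; _*_; _∸_; _^_; _/_; _%_; _⊔_; _≤_; _<_; z≤n; s≤s; _≟_; _≤?_; _≡ᵇ_; NonZero)
open import Data.Nat.DivMod
  using (m/n*n≤m; m*n/n≡m; m≡m%n+[m/n]*n; m%n<n; [m+kn]%n≡m%n; +-distrib-/-∣ʳ; m<n⇒m/n≡0)
open import Data.Nat.Divisibility using (divides-refl)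
import Data.Nat.ListAction as ListAction
open import Data.Nat.Properties
open import Data.Nat.Tactic.RingSolver using (solve-∀)
open import Data.Product using (∃; _×_; _,_; proj₁; proj₂)
open import Data.Rational as ℚ using (ℚ; ↥_; ↧_; ↧ₙ_; floor; ceiling; ½) renaming (_*_ to _*ℚ_)
import Data.Rational.Properties as ℚ
open import Data.Sum using (inj₁; inj₂)
open import Data.Vec using ([]; _∷_; lookup)
open import Data.Vec.Properties using (lookup-replicate)
open import Function using (_∘_)
open import Relation.Binary.PropositionalEquality
open import Relation.Nullary using (yes; no; contradiction)
open import Relation.Nullary.Decidable using (dec-true; dec-false)
import Algebra.Properties.CommutativeSemigroup *-commutativeSemigroup as ℕ*
import Algebra.Properties.CommutativeSemigroup ℤ.*-commutativeSemigroup as ℤ*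
open import Algebra.Properties.Semiring.Sum +-*-semiring
  using (sum; sum-syntax; sum-cong-≗; ∑-comm; ∑-distrib-+; *-distribˡ-sum; *-distribʳ-sum)

-- Finite sums

⟦_⟧ : Bool → ℕ
⟦ b ⟧ = if b then 1 else 0

⟦⟧≤1 : ∀ b → ⟦ b ⟧ ≤ 1
⟦⟧≤1 true  = s≤s z≤n
⟦⟧≤1 false = z≤n

⟦⟧*⟦⟧≢0 : ∀ a b → ⟦ a ⟧ * ⟦ b ⟧ ≢ 0 → a ≡ true × b ≡ true
⟦⟧*⟦⟧≢0 true  true  _   = refl , refl
⟦⟧*⟦⟧≢0 true  false ≢0 = contradiction refl ≢0
⟦⟧*⟦⟧≢0 false _     ≢0 = contradiction refl ≢0

⟦⟧≡0⇒false : ∀ {b} → ⟦ b ⟧ ≡ 0 → b ≡ false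
⟦⟧≡0⇒false {false} _ = refl

⟦⟧≢0⇒true : ∀ {b} → ⟦ b ⟧ ≢ 0 → b ≡ true
⟦⟧≢0⇒true {true}  _   = refl
⟦⟧≢0⇒true {false} b≢0 = contradiction refl b≢0

sum-mono-≤ : ∀ {n} {f g : Fin n → ℕ} → (∀ i → f i ≤ g i) → sum f ≤ sum g
sum-mono-≤ {zero}  f≤g = z≤n
sum-mono-≤ {suc n} f≤g = +-mono-≤ (f≤g zero) (sum-mono-≤ (f≤g ∘ suc))

term≤sum : ∀ {n} (f : Fin n → ℕ) i → f i ≤ sum f
term≤sum f zero    = m≤m+n _ _
term≤sum f (suc i) = ≤-trans (term≤sum (f ∘ suc) i) (m≤n+m _ (f zero))

sum-const : ∀ n c → ∑[ i < n ] c ≡ n * c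
sum-const zero    c = refl
sum-const (suc n) c = cong (_+_ c) (sum-const n c)

sum-zero : ∀ {n} {f : Fin n → ℕ} → (∀ i → f i ≡ 0) → sum f ≡ 0
sum-zero {n} f≡0 = trans (sum-cong-≗ f≡0) (trans (sum-const n 0) (*-zeroʳ n))

sum-supported-at : ∀ {n} {f : Fin n → ℕ} i → (∀ j → j ≢ i → f j ≡ 0) → sum f ≡ f i
sum-supported-at {suc n} {f} zero    f≡0 =
  trans (cong (_+_ (f zero)) (sum-zero (λ j → f≡0 (suc j) λ ()))) (+-identityʳ _)
sum-supported-at {suc n} {f} (suc i) f≡0 =
  cong₂ _+_ (f≡0 zero λ ()) (sum-supported-at i λ j j≢i → f≡0 (suc j) (j≢i ∘ Fin.suc-injective))

sum≡0⇒≡0 : ∀ {n} (f : Fin n → ℕ) → sum f ≡ 0 → ∀ i → f i ≡ 0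
sum≡0⇒≡0 f ∑f≡0 i = n≤0⇒n≡0 (≤-trans (term≤sum f i) (≤-reflexive ∑f≡0))

sum≢0⇒∃≢0 : ∀ {n} (f : Fin n → ℕ) → sum f ≢ 0 → ∃ λ i → f i ≢ 0
sum≢0⇒∃≢0 {zero}  f ∑f≢0 = contradiction refl ∑f≢0
sum≢0⇒∃≢0 {suc n} f ∑f≢0 with f zero ≟ 0
... | no  f₀≢0 = zero , f₀≢0
... | yes f₀≡0 with sum≢0⇒∃≢0 (f ∘ suc) (∑f≢0 ∘ cong₂ _+_ f₀≡0)
...   | i , fᵢ≢0 = suc i , fᵢ≢0

sum<n⇒∃≡0 : ∀ {n} (f : Fin n → ℕ) → sum f < n → ∃ λ i → f i ≡ 0
sum<n⇒∃≡0 {suc n} f ∑f<n with f zero in eq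
... | zero  = zero , eq
... | suc _ with sum<n⇒∃≡0 (f ∘ suc) (≤-trans (s≤s (m≤n+m _ _)) (≤-pred ∑f<n))
...   | i , fᵢ≡0 = suc i , fᵢ≡0

pigeonhole : ∀ {n m c} (a : Fin n → Fin m → ℕ) → (∀ i → ∑[ j < m ] a i j ≤ c) → n * c < m →
             ∃ λ j → ∀ i → a i j ≡ 0
pigeonhole {n} {m} {c} a row≤c n*c<m = j , sum≡0⇒≡0 (λ i → a i j) column≡0
  where
  total<m : ∑[ j < m ] ∑[ i < n ] a i j < m
  total<m = begin-strict
    ∑[ j < m ] ∑[ i < n ] a i j  ≡⟨ ∑-comm (λ j i → a i j) ⟩
    ∑[ i < n ] ∑[ j < m ] a i j  ≤⟨ sum-mono-≤ row≤c ⟩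
    ∑[ i < n ] c                 ≡⟨ sum-const n c ⟩
    n * c                        <⟨ n*c<m ⟩
    m                            ∎
    where open ≤-Reasoning
  j = proj₁ (sum<n⇒∃≡0 _ total<m)
  column≡0 = proj₂ (sum<n⇒∃≡0 _ total<m)

sum-↑ : ∀ m {n} (f : Fin (m + n) → ℕ) → sum f ≡ ∑[ i < m ] f (i ↑ˡ n) + ∑[ j < n ] f (m ↑ʳ j)
sum-↑ zero    f = refl
sum-↑ (suc m) f = trans (cong (_+_ (f zero)) (sum-↑ m (f ∘ suc))) (sym (+-assoc (f zero) _ _))

sum-combine : ∀ m n (f : Fin (m * n) → ℕ) → sum f ≡ ∑[ i < m ] ∑[ j < n ] f (combine i j)
sum-combine zero    n f = refl
sum-combine (suc m) n f = trans (sum-↑ n f) (cong (_+_ (∑[ j < n ] f (j ↑ˡ m * n))) (sum-combine m n (f ∘ (n ↑ʳ_))))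

sumList-allFin : ∀ n (f : Fin n → ℕ) → ListAction.sum (List.map f (allFin n)) ≡ sum f
sumList-allFin n f = trans (cong ListAction.sum (map-tabulate (λ i → i) f)) (sumList-tabulate n)
  where
  sumList-tabulate : ∀ n {f : Fin n → ℕ} → ListAction.sum (tabulate f) ≡ sum f
  sumList-tabulate zero    = refl
  sumList-tabulate (suc n) {f} = cong (_+_ (f zero)) (sumList-tabulate n)

≤-foldr-⊔ : ∀ n (f : Fin n → ℕ) i → f i ≤ List.foldr _⊔_ 0 (List.map f (allFin n))
≤-foldr-⊔ n f i = subst (f i ≤_) (cong (List.foldr _⊔_ 0) (sym (map-tabulate (λ i → i) f))) (go n f i)
  where
  go : ∀ n (f : Fin n → ℕ) i → f i ≤ List.foldr _⊔_ 0 (tabulate f)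
  go (suc n) f zero    = m≤m⊔n _ _
  go (suc n) f (suc i) = m≤n⇒m≤o⊔n (f zero) (go n (f ∘ suc) i)

≡ᵇ-true⇒≡ : ∀ {m n} → (m ≡ᵇ n) ≡ true → m ≡ n
≡ᵇ-true⇒≡ {m} {n} e = ≡ᵇ⇒≡ m n (subst T (sym e) _)

-- dec-true and dec-false apply to _≡ᵇ_ because does (m ≟ n) reduces to m ≡ᵇ n.
level-decomposition : ∀ {N d} → d < N → d ≡ ∑[ ℓ < N ] (toℕ ℓ * ⟦ d ≡ᵇ toℕ ℓ ⟧)
level-decomposition {N} {d} d<N = sym (begin
  ∑[ ℓ < N ] (toℕ ℓ * ⟦ d ≡ᵇ toℕ ℓ ⟧)  ≡⟨ sum-supported-at (fromℕ< d<N) off-level ⟩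
  toℕ ℓ₀ * ⟦ d ≡ᵇ toℕ ℓ₀ ⟧              ≡⟨ cong (λ m → m * ⟦ d ≡ᵇ m ⟧) (toℕ-fromℕ< d<N) ⟩
  d * ⟦ d ≡ᵇ d ⟧                         ≡⟨ cong (λ b → d * ⟦ b ⟧) (dec-true (d ≟ d) refl) ⟩
  d * 1                                  ≡⟨ *-identityʳ d ⟩
  d                                      ∎)
  where
  open ≡-Reasoning
  ℓ₀ = fromℕ< d<N
  off-level : ∀ ℓ → ℓ ≢ ℓ₀ → toℕ ℓ * ⟦ d ≡ᵇ toℕ ℓ ⟧ ≡ 0
  off-level ℓ ℓ≢ℓ₀ = trans (cong (λ b → toℕ ℓ * ⟦ b ⟧) (dec-false (d ≟ toℕ ℓ) d≢ℓ)) (*-zeroʳ (toℕ ℓ))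
    where
    d≢ℓ : d ≢ toℕ ℓ
    d≢ℓ d≡ℓ = ℓ≢ℓ₀ (toℕ-injective (trans (sym d≡ℓ) (sym (toℕ-fromℕ< d<N))))

sum-by-level : ∀ {m N} (w d : Fin m → ℕ) → (∀ i → d i < N) →
               ∑[ i < m ] (w i * d i) ≡ ∑[ ℓ < N ] (toℕ ℓ * ∑[ i < m ] (w i * ⟦ d i ≡ᵇ toℕ ℓ ⟧))
sum-by-level {m} {N} w d d<N = begin
  ∑[ i < m ] (w i * d i)
    ≡⟨ sum-cong-≗ {m} (λ i → cong (w i *_) (level-decomposition (d<N i))) ⟩
  ∑[ i < m ] (w i * ∑[ ℓ < N ] (toℕ ℓ * ⟦ d i ≡ᵇ toℕ ℓ ⟧))
    ≡⟨ sum-cong-≗ {m} (λ i → *-distribˡ-sum {N} (w i) (λ ℓ → toℕ ℓ * ⟦ d i ≡ᵇ toℕ ℓ ⟧)) ⟩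
  ∑[ i < m ] ∑[ ℓ < N ] (w i * (toℕ ℓ * ⟦ d i ≡ᵇ toℕ ℓ ⟧))
    ≡⟨ ∑-comm {m} {N} (λ i ℓ → w i * (toℕ ℓ * ⟦ d i ≡ᵇ toℕ ℓ ⟧)) ⟩
  ∑[ ℓ < N ] ∑[ i < m ] (w i * (toℕ ℓ * ⟦ d i ≡ᵇ toℕ ℓ ⟧))
    ≡⟨ sum-cong-≗ {N} (λ ℓ → sum-cong-≗ {m} λ i → ℕ*.x∙yz≈y∙xz (w i) (toℕ ℓ) _) ⟩
  ∑[ ℓ < N ] ∑[ i < m ] (toℕ ℓ * (w i * ⟦ d i ≡ᵇ toℕ ℓ ⟧))
    ≡⟨ sum-cong-≗ {N} (λ ℓ → *-distribˡ-sum {m} (toℕ ℓ) (λ i → w i * ⟦ d i ≡ᵇ toℕ ℓ ⟧)) ⟨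
  ∑[ ℓ < N ] (toℕ ℓ * ∑[ i < m ] (w i * ⟦ d i ≡ᵇ toℕ ℓ ⟧))
    ∎
  where open ≡-Reasoning

arithmetic-series : ∀ a t → 2 * ∑[ j < t ] (a + toℕ j) + t ≡ t * (2 * a + t)
arithmetic-series a zero    = refl
arithmetic-series a (suc t) = begin
  2 * (a + 0 + ∑[ j < t ] (a + suc (toℕ j))) + suc t
    ≡⟨ cong (λ m → 2 * (a + 0 + m) + suc t) (sum-cong-≗ {t} λ j → +-suc a (toℕ j)) ⟩
  2 * (a + 0 + ∑[ j < t ] (suc a + toℕ j)) + suc t
    ≡⟨ step a t (∑[ j < t ] (suc a + toℕ j)) ⟩
  (2 * ∑[ j < t ] (suc a + toℕ j) + t) + (2 * a + 1)
    ≡⟨ cong (_+ (2 * a + 1)) (arithmetic-series (suc a) t) ⟩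
  t * (2 * suc a + t) + (2 * a + 1)
    ≡⟨ closed a t ⟩
  suc t * (2 * a + suc t)
    ∎
  where
  open ≡-Reasoning
  step : ∀ a t s → 2 * (a + 0 + s) + suc t ≡ (2 * s + t) + (2 * a + 1)
  step = solve-∀
  closed : ∀ a t → t * (2 * suc a + t) + (2 * a + 1) ≡ suc t * (2 * a + suc t)
  closed = solve-∀

-- Orientations, discharging and bicliques

countF≡sum : ∀ {n} (p : Fin n → Bool) → countF p ≡ ∑[ i < n ] ⟦ p i ⟧
countF≡sum {n} p = sumList-allFin n (⟦_⟧ ∘ p)

edgeEnds : {G : Graph} → Subgraph G → ℕ
edgeEnds {G} H = ∑[ u < n G ] ∑[ v < n G ] ⟦ inE H u v ⟧

∣E∣≡edgeEnds/2 : {G : Graph} (H : Subgraph G) → ∣E∣ H ≡ edgeEnds H / 2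
∣E∣≡edgeEnds/2 {G} H =
  cong (_/ 2) (trans (sumList-allFin (n G) (countF ∘ inE H)) (sum-cong-≗ (countF≡sum ∘ inE H)))

2*∣E∣≤edgeEnds : {G : Graph} (H : Subgraph G) → 2 * ∣E∣ H ≤ edgeEnds H
2*∣E∣≤edgeEnds H = begin
  2 * ∣E∣ H               ≡⟨ cong (2 *_) (∣E∣≡edgeEnds/2 H) ⟩
  2 * (edgeEnds H / 2)    ≡⟨ *-comm 2 (edgeEnds H / 2) ⟩
  edgeEnds H / 2 * 2      ≤⟨ m/n*n≤m (edgeEnds H) 2 ⟩
  edgeEnds H              ∎
  where open ≤-Reasoning

module _ {G : Graph} (D : Orientation G) where

  outdeg≤Δ⁺ : ∀ u → outdeg D u ≤ Δ⁺ D
  outdeg≤Δ⁺ = ≤-foldr-⊔ (n G) (outdeg D)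

  outdeg≡sum : ∀ u → outdeg D u ≡ ∑[ v < n G ] ⟦ arc D u v ⟧
  outdeg≡sum u = countF≡sum (arc D u)

  arc-absent : ∀ {u v} → adj G u v ≡ false → arc D u v ≡ false
  arc-absent {u} {v} ¬uv with arc D u v in uv
  ... | false = refl
  ... | true  = trans (sym (arc-adj D u v uv)) ¬uv

  arc-forced : ∀ {u v} → adj G u v ≡ true → arc D v u ≡ false → arc D u v ≡ true
  arc-forced {u} {v} e ¬vu with orient D u v e
  ... | inj₁ (uv , _) = uv
  ... | inj₂ (_ , vu) = contradiction (trans (sym vu) ¬vu) λ ()

  arcs-of-edge : ∀ {u v} → adj G u v ≡ true → ⟦ arc D u v ⟧ + ⟦ arc D v u ⟧ ≡ 1
  arcs-of-edge {u} {v} e with orient D u v e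
  ... | inj₁ (uv , vu) rewrite uv | vu = refl
  ... | inj₂ (uv , vu) rewrite uv | vu = refl

adjacentPairs : (G : Graph) → (Fin (n G) → Bool) → ℕ
adjacentPairs G X = ∑[ u < n G ] ∑[ v < n G ] ⟦ X u ∧ (X v ∧ adj G u v) ⟧

module _ {G : Graph} (D : Orientation G) (X : Fin (n G) → Bool) where

  private
    arcWithin : Fin (n G) → Fin (n G) → ℕ
    arcWithin u v = ⟦ X u ∧ (X v ∧ arc D u v) ⟧

    pair≤arcs : ∀ u v → ⟦ X u ∧ (X v ∧ adj G u v) ⟧ ≤ arcWithin u v + arcWithin v u
    pair≤arcs u v with X u | X v | adj G u v in e
    ... | true  | true  | true  = ≤-reflexive (sym (arcs-of-edge D e))
    ... | true  | true  | false = z≤n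
    ... | true  | false | _     = z≤n
    ... | false | _     | _     = z≤n

    arcWithin≤ : ∀ u v → arcWithin u v ≤ ⟦ X u ⟧ * ⟦ arc D u v ⟧
    arcWithin≤ u v with X u | X v
    ... | true  | true  = ≤-reflexive (sym (+-identityʳ _))
    ... | true  | false = z≤n
    ... | false | _     = z≤n

  adjacentPairs≤2*∑outdeg : adjacentPairs G X ≤ 2 * ∑[ u < n G ] (⟦ X u ⟧ * outdeg D u)
  adjacentPairs≤2*∑outdeg = begin
    adjacentPairs G X
      ≤⟨ sum-mono-≤ (λ u → sum-mono-≤ (pair≤arcs u)) ⟩
    ∑[ u < n G ] ∑[ v < n G ] (arcWithin u v + arcWithin v u)
      ≡⟨ sum-cong-≗ (λ u → ∑-distrib-+ (arcWithin u) (λ v → arcWithin v u)) ⟩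
    ∑[ u < n G ] (∑[ v < n G ] arcWithin u v + ∑[ v < n G ] arcWithin v u)
      ≡⟨ ∑-distrib-+ (λ u → ∑[ v < n G ] arcWithin u v) (λ u → ∑[ v < n G ] arcWithin v u) ⟩
    A + ∑[ u < n G ] ∑[ v < n G ] arcWithin v u
      ≡⟨ cong (_+_ A) (∑-comm (λ u v → arcWithin v u)) ⟩
    A + A
      ≡⟨ cong (_+_ A) (sym (+-identityʳ A)) ⟩
    2 * A
      ≤⟨ *-monoʳ-≤ 2 (sum-mono-≤ λ u → sum-mono-≤ (arcWithin≤ u)) ⟩
    2 * ∑[ u < n G ] ∑[ v < n G ] (⟦ X u ⟧ * ⟦ arc D u v ⟧)
      ≡⟨ cong (2 *_) (sum-cong-≗ λ u → trans (sym (*-distribˡ-sum ⟦ X u ⟧ (⟦_⟧ ∘ arc D u)))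
                                             (cong (⟦ X u ⟧ *_) (sym (outdeg≡sum D u)))) ⟩
    2 * ∑[ u < n G ] (⟦ X u ⟧ * outdeg D u)
      ∎
    where
    open ≤-Reasoning
    A = ∑[ u < n G ] ∑[ v < n G ] arcWithin u v

module _ {G : Graph} (ch : Fin (n G) → Fin (n G) → ℕ)
         (ch-edge : ∀ u v → adj G u v ≡ true → ch u v + ch v u ≡ 2) where

  edgeEnds≡charge : (H : Subgraph G) → edgeEnds H ≡ ∑[ u < n G ] ∑[ v < n G ] (⟦ inE H u v ⟧ * ch u v)
  edgeEnds≡charge H = *-cancelʳ-≡ _ _ 2 (begin
    edgeEnds H * 2
      ≡⟨ *-distribʳ-sum 2 (λ u → ∑[ v < n G ] ⟦ inE H u v ⟧) ⟩
    ∑[ u < n G ] ((∑[ v < n G ] ⟦ inE H u v ⟧) * 2)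
      ≡⟨ sum-cong-≗ (λ u → trans (*-distribʳ-sum 2 (⟦_⟧ ∘ inE H u))
                                 (trans (sum-cong-≗ (split u)) (∑-distrib-+ (Q u) (Q′ u)))) ⟩
    ∑[ u < n G ] (∑[ v < n G ] Q u v + ∑[ v < n G ] Q′ u v)
      ≡⟨ ∑-distrib-+ (λ u → ∑[ v < n G ] Q u v) (λ u → ∑[ v < n G ] Q′ u v) ⟩
    ∑Q + ∑[ u < n G ] ∑[ v < n G ] Q′ u v
      ≡⟨ cong (_+_ ∑Q) (trans (∑-comm Q′) (sum-cong-≗ λ v → sum-cong-≗ λ u →
                                              cong (λ b → ⟦ b ⟧ * ch v u) (inE-sym H u v))) ⟩
    ∑Q + ∑Q
      ≡⟨ cong (_+_ ∑Q) (*-identityʳ ∑Q) ⟨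
    ∑Q + ∑Q * 1
      ≡⟨ *-suc ∑Q 1 ⟨
    ∑Q * 2
      ∎)
    where
    open ≡-Reasoning
    Q Q′ : Fin (n G) → Fin (n G) → ℕ
    Q  u v = ⟦ inE H u v ⟧ * ch u v
    Q′ u v = ⟦ inE H u v ⟧ * ch v u
    ∑Q = ∑[ u < n G ] ∑[ v < n G ] Q u v
    split : ∀ u v → ⟦ inE H u v ⟧ * 2 ≡ Q u v + Q′ u v
    split u v with inE H u v in e
    ... | false = refl
    ... | true  = trans (cong (1 *_) (sym (ch-edge u v (inE-adj H u v e)))) (*-distribˡ-+ 1 (ch u v) (ch v u))

  discharging : ∀ {c} → (∀ u → ∑[ v < n G ] (ch u v * ⟦ adj G u v ⟧) ≤ c) →
                (H : Subgraph G) → 2 * ∣E∣ H ≤ c * ∣V∣ H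
  discharging {c} charge≤c H = begin
    2 * ∣E∣ H
      ≤⟨ 2*∣E∣≤edgeEnds H ⟩
    edgeEnds H
      ≡⟨ edgeEnds≡charge H ⟩
    ∑[ u < n G ] ∑[ v < n G ] (⟦ inE H u v ⟧ * ch u v)
      ≤⟨ sum-mono-≤ (λ u → sum-mono-≤ (inE≤ u)) ⟩
    ∑[ u < n G ] ∑[ v < n G ] (⟦ inV H u ⟧ * (ch u v * ⟦ adj G u v ⟧))
      ≡⟨ sum-cong-≗ (λ u → sym (*-distribˡ-sum ⟦ inV H u ⟧ (λ v → ch u v * ⟦ adj G u v ⟧))) ⟩
    ∑[ u < n G ] (⟦ inV H u ⟧ * ∑[ v < n G ] (ch u v * ⟦ adj G u v ⟧))
      ≤⟨ sum-mono-≤ (λ u → *-monoʳ-≤ ⟦ inV H u ⟧ (charge≤c u)) ⟩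
    ∑[ u < n G ] (⟦ inV H u ⟧ * c)
      ≡⟨ *-distribʳ-sum c (⟦_⟧ ∘ inV H) ⟨
    ∑[ u < n G ] ⟦ inV H u ⟧ * c
      ≡⟨ trans (*-comm c (∣V∣ H)) (cong (_* c) (countF≡sum (inV H))) ⟨
    c * ∣V∣ H
      ∎
    where
    open ≤-Reasoning
    inE≤ : ∀ u v → ⟦ inE H u v ⟧ * ch u v ≤ ⟦ inV H u ⟧ * (ch u v * ⟦ adj G u v ⟧)
    inE≤ u v with inE H u v in e
    ... | false = z≤n
    ... | true rewrite inE-inV H u v e | inE-adj H u v e = ≤-reflexive (cong (_+ 0) (sym (*-identityʳ (ch u v))))

induced : (G : Graph) → (∀ u v → adj G u v ≡ adj G v u) → (Fin (n G) → Bool) → Subgraph G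
induced G adj-sym X = record
  { inV     = X
  ; inE     = λ u v → X u ∧ (X v ∧ adj G u v)
  ; inE-sym = sym-within
  ; inE-adj = λ u v e → ∧-conicalʳ (X v) _ (∧-conicalʳ (X u) _ e)
  ; inE-inV = λ u v e → ∧-conicalˡ _ _ e
  }
  where
  sym-within : ∀ u v → X u ∧ (X v ∧ adj G u v) ≡ X v ∧ (X u ∧ adj G v u)
  sym-within u v with X u | X v
  ... | true  | true  = adj-sym u v
  ... | true  | false = refl
  ... | false | true  = refl
  ... | false | false = refl

module Biclique (G : Graph) (adj-sym : ∀ u v → adj G u v ≡ adj G v u) (X Y : Fin (n G) → Bool)
         (disjoint : ∀ v → X v ≡ true → Y v ≡ false)
         (complete : ∀ u v → X u ≡ true → Y v ≡ true → adj G u v ≡ true)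
         (X-independent : ∀ u v → X u ≡ true → X v ≡ true → adj G u v ≡ false)
         (Y-independent : ∀ u v → Y u ≡ true → Y v ≡ true → adj G u v ≡ false) where

  private
    X∪Y : Fin (n G) → Bool
    X∪Y v = X v ∨ Y v

    pair≡ : ∀ u v → ⟦ X∪Y u ∧ (X∪Y v ∧ adj G u v) ⟧ ≡ ⟦ X u ⟧ * ⟦ Y v ⟧ + ⟦ Y u ⟧ * ⟦ X v ⟧
    pair≡ u v with X u in Xu | X v in Xv
    ... | true  | true  rewrite disjoint u Xu | disjoint v Xv | X-independent u v Xu Xv = refl
    ... | true  | false rewrite disjoint u Xu with Y v in Yv
    ...   | true  rewrite complete u v Xu Yv = refl
    ...   | false = refl
    pair≡ u v | false | true with Y u in Yu
    ...   | true  rewrite adj-sym u v | complete v u Xv Yu = refl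
    ...   | false = refl
    pair≡ u v | false | false with Y u in Yu | Y v in Yv
    ...   | true  | true  rewrite Y-independent u v Yu Yv = refl
    ...   | true  | false = refl
    ...   | false | _     = refl

  countF-∪ : countF X∪Y ≡ countF X + countF Y
  countF-∪ = begin
    countF X∪Y                                   ≡⟨ countF≡sum X∪Y ⟩
    ∑[ v < n G ] ⟦ X∪Y v ⟧                       ≡⟨ sum-cong-≗ ⟦∪⟧ ⟩
    ∑[ v < n G ] (⟦ X v ⟧ + ⟦ Y v ⟧)             ≡⟨ ∑-distrib-+ (⟦_⟧ ∘ X) (⟦_⟧ ∘ Y) ⟩
    ∑[ v < n G ] ⟦ X v ⟧ + ∑[ v < n G ] ⟦ Y v ⟧ ≡⟨ cong₂ _+_ (countF≡sum X) (countF≡sum Y) ⟨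
    countF X + countF Y                          ∎
    where
    open ≡-Reasoning
    ⟦∪⟧ : ∀ v → ⟦ X∪Y v ⟧ ≡ ⟦ X v ⟧ + ⟦ Y v ⟧
    ⟦∪⟧ v with X v in Xv
    ... | true  rewrite disjoint v Xv = refl
    ... | false = refl

  adjacentPairs-biclique : adjacentPairs G X∪Y ≡ 2 * (countF X * countF Y)
  adjacentPairs-biclique = begin
    adjacentPairs G X∪Y
      ≡⟨ sum-cong-≗ (λ u → trans (sum-cong-≗ (pair≡ u)) (∑-distrib-+ (XY u) (YX u))) ⟩
    ∑[ u < n G ] (∑[ v < n G ] (⟦ X u ⟧ * ⟦ Y v ⟧) + ∑[ v < n G ] (⟦ Y u ⟧ * ⟦ X v ⟧))
      ≡⟨ ∑-distrib-+ (λ u → ∑[ v < n G ] XY u v) (λ u → ∑[ v < n G ] YX u v) ⟩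
    ∑[ u < n G ] ∑[ v < n G ] (⟦ X u ⟧ * ⟦ Y v ⟧) + ∑[ u < n G ] ∑[ v < n G ] (⟦ Y u ⟧ * ⟦ X v ⟧)
      ≡⟨ cong₂ _+_ (product X Y) (product Y X) ⟩
    countF X * countF Y + countF Y * countF X
      ≡⟨ cong (_+_ (countF X * countF Y)) (trans (*-comm (countF Y) _) (sym (+-identityʳ _))) ⟩
    2 * (countF X * countF Y)
      ∎
    where
    open ≡-Reasoning
    XY YX : Fin (n G) → Fin (n G) → ℕ
    XY u v = ⟦ X u ⟧ * ⟦ Y v ⟧
    YX u v = ⟦ Y u ⟧ * ⟦ X v ⟧
    product : ∀ Z W → ∑[ u < n G ] ∑[ v < n G ] (⟦ Z u ⟧ * ⟦ W v ⟧) ≡ countF Z * countF W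
    product Z W = begin
      ∑[ u < n G ] ∑[ v < n G ] (⟦ Z u ⟧ * ⟦ W v ⟧) ≡⟨ sum-cong-≗ (λ u → *-distribˡ-sum ⟦ Z u ⟧ (⟦_⟧ ∘ W)) ⟨
      ∑[ u < n G ] (⟦ Z u ⟧ * ∑[ v < n G ] ⟦ W v ⟧)  ≡⟨ *-distribʳ-sum (∑[ v < n G ] ⟦ W v ⟧) (⟦_⟧ ∘ Z) ⟨
      ∑[ u < n G ] ⟦ Z u ⟧ * ∑[ v < n G ] ⟦ W v ⟧    ≡⟨ cong₂ _*_ (countF≡sum Z) (countF≡sum W) ⟨
      countF Z * countF W                            ∎

-- Ceilings of rationals

floor-unique : ∀ p z → z ℤ.* ↧ p ℤ.≤ ↥ p → ↥ p ℤ.< sucℤ z ℤ.* ↧ p → floor p ≡ z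
floor-unique p@record{} z lower upper = trans (div-pos-is-/ℕ (↥ p) (↧ₙ p)) (ℤ.≤-antisym w≤z z≤w)
  where
  w = ↥ p ℤ./ℕ ↧ₙ p
  <suc⇒≤ : ∀ {i j} → i ℤ.< sucℤ j → i ℤ.≤ j
  <suc⇒≤ {i} {j} i<j+1 = subst (i ℤ.≤_) (ℤ.pred-suc j) (ℤ.i<j⇒i≤pred[j] i<j+1)
  w≤z : w ℤ.≤ z
  w≤z = <suc⇒≤ (ℤ.*-cancelʳ-<-nonNeg (↧ p) (ℤ.≤-<-trans ([n/ℕd]*d≤n (↥ p) (↧ₙ p)) upper))
  z≤w : z ℤ.≤ w
  z≤w = <suc⇒≤ (ℤ.*-cancelʳ-<-nonNeg (↧ p) (ℤ.≤-<-trans lower (n<s[n/ℕd]*d (↥ p) (↧ₙ p))))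

ceiling-unique : ∀ p k → + k ℤ.* ↧ p ℤ.< ↥ p → ↥ p ℤ.≤ + suc k ℤ.* ↧ p → ceiling p ≡ + suc k
ceiling-unique p@record{} k lower upper = cong ℤ.-_ (floor-unique (ℚ.- p) -[1+ k ] lower′ upper′)
  where
  open ℤ.≤-Reasoning
  lower′ : -[1+ k ] ℤ.* ↧ (ℚ.- p) ℤ.≤ ↥ (ℚ.- p)
  lower′ = begin
    -[1+ k ] ℤ.* ↧ (ℚ.- p)      ≡⟨ cong (-[1+ k ] ℤ.*_) (ℚ.↧-neg p) ⟩
    -[1+ k ] ℤ.* ↧ p            ≡⟨ ℤ.neg-distribˡ-* (+ suc k) (↧ p) ⟨
    ℤ.- (+ suc k ℤ.* ↧ p)       ≤⟨ ℤ.neg-mono-≤ upper ⟩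
    ℤ.- ↥ p                     ≡⟨ ℚ.↥-neg p ⟨
    ↥ (ℚ.- p)                   ∎
  suc-neg : ∀ k → sucℤ -[1+ k ] ≡ ℤ.- (+ k)
  suc-neg zero    = refl
  suc-neg (suc k) = refl
  upper′ : ↥ (ℚ.- p) ℤ.< sucℤ -[1+ k ] ℤ.* ↧ (ℚ.- p)
  upper′ = begin-strict
    ↥ (ℚ.- p)                   ≡⟨ ℚ.↥-neg p ⟩
    ℤ.- ↥ p                     <⟨ ℤ.neg-mono-< lower ⟩
    ℤ.- (+ k ℤ.* ↧ p)           ≡⟨ ℤ.neg-distribˡ-* (+ k) (↧ p) ⟩
    ℤ.- (+ k) ℤ.* ↧ p           ≡⟨ cong₂ ℤ._*_ (suc-neg k) (ℚ.↧-neg p) ⟨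
    sucℤ -[1+ k ] ℤ.* ↧ (ℚ.- p) ∎

module _ {x x′ : ℤ} {m m′ : ℕ} (same : x ℤ.* +[1+ m′ ] ≡ x′ ℤ.* +[1+ m ]) where

  cross-< : ∀ c → c ℤ.* +[1+ m ] ℤ.< x → c ℤ.* +[1+ m′ ] ℤ.< x′
  cross-< c cd<x = ℤ.*-cancelʳ-<-nonNeg +[1+ m ] (begin-strict
    c ℤ.* +[1+ m′ ] ℤ.* +[1+ m ]   ≡⟨ ℤ*.xy∙z≈xz∙y c +[1+ m′ ] +[1+ m ] ⟩
    c ℤ.* +[1+ m ] ℤ.* +[1+ m′ ]   <⟨ ℤ.*-monoʳ-<-pos +[1+ m′ ] cd<x ⟩
    x ℤ.* +[1+ m′ ]                ≡⟨ same ⟩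
    x′ ℤ.* +[1+ m ]                ∎)
    where open ℤ.≤-Reasoning

  cross-≤ : ∀ c → x ℤ.≤ c ℤ.* +[1+ m ] → x′ ℤ.≤ c ℤ.* +[1+ m′ ]
  cross-≤ c x≤cd = ℤ.*-cancelʳ-≤-pos x′ (c ℤ.* +[1+ m′ ]) +[1+ m ] (begin
    x′ ℤ.* +[1+ m ]                ≡⟨ same ⟨
    x ℤ.* +[1+ m′ ]                ≤⟨ ℤ.*-monoʳ-≤-nonNeg +[1+ m′ ] x≤cd ⟩
    c ℤ.* +[1+ m ] ℤ.* +[1+ m′ ]   ≡⟨ ℤ*.xy∙z≈xz∙y c +[1+ m ] +[1+ m′ ] ⟩
    c ℤ.* +[1+ m′ ] ℤ.* +[1+ m ]   ∎)
    where open ℤ.≤-Reasoning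

↥/-cross : ∀ i n .{{_ : NonZero n}} → ↥ (i ℚ./ n) ℤ.* + n ≡ i ℤ.* ↧ (i ℚ./ n)
↥/-cross i n = begin
  ↥ (i ℚ./ n) ℤ.* + n               ≡⟨ cong (↥ (i ℚ./ n) ℤ.*_) (ℚ.↧-/ i n) ⟨
  ↥ (i ℚ./ n) ℤ.* (↧ (i ℚ./ n) ℤ.* g) ≡⟨ ℤ*.x∙yz≈xz∙y (↥ (i ℚ./ n)) (↧ (i ℚ./ n)) g ⟩
  ↥ (i ℚ./ n) ℤ.* g ℤ.* ↧ (i ℚ./ n)   ≡⟨ cong (ℤ._* ↧ (i ℚ./ n)) (ℚ.↥-/ i n) ⟩
  i ℤ.* ↧ (i ℚ./ n)                 ∎
  where
  open ≡-Reasoning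
  g = gcd i (+ n)

↥*½-cross : ∀ q → ↥ (q *ℚ ½) ℤ.* (↧ q ℤ.* + 2) ≡ ↥ q ℤ.* ↧ (q *ℚ ½)
↥*½-cross q = begin
  ↥ h ℤ.* (↧ q ℤ.* + 2)        ≡⟨ cong (↥ h ℤ.*_) (ℚ.↧-* q ½) ⟨
  ↥ h ℤ.* (↧ h ℤ.* g)          ≡⟨ ℤ*.x∙yz≈xz∙y (↥ h) (↧ h) g ⟩
  ↥ h ℤ.* g ℤ.* ↧ h            ≡⟨ cong (ℤ._* ↧ h) (ℚ.↥-* q ½) ⟩
  ↥ q ℤ.* + 1 ℤ.* ↧ h          ≡⟨ cong (ℤ._* ↧ h) (ℤ.*-identityʳ (↥ q)) ⟩
  ↥ q ℤ.* ↧ h                  ∎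
  where
  open ≡-Reasoning
  h = q *ℚ ½
  g = gcd (↥ q ℤ.* ↥ ½) (↧ q ℤ.* ↧ ½)

ceiling-half : ∀ q k → + (2 * k) ℤ.* ↧ q ℤ.< ↥ q → ↥ q ℤ.≤ + (2 * suc k) ℤ.* ↧ q → ceiling (q *ℚ ½) ≡ + suc k
ceiling-half q k lower upper = ceiling-unique (q *ℚ ½) k
  (cross-< same (+ k) (subst (ℤ._< ↥ q) (halve k) lower))
  (cross-≤ same (+ suc k) (subst (↥ q ℤ.≤_) (halve (suc k)) upper))
  where
  same : ↥ q ℤ.* ↧ (q *ℚ ½) ≡ ↥ (q *ℚ ½) ℤ.* (↧ q ℤ.* + 2)
  same = sym (↥*½-cross q)
  halve : ∀ n → + (2 * n) ℤ.* ↧ q ≡ + n ℤ.* (↧ q ℤ.* + 2)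
  halve n = trans (cong (ℤ._* ↧ q) (ℤ.pos-* 2 n)) (ℤ*.xy∙z≈y∙zx (+ 2) (+ n) (↧ q))

fraction≤ : ∀ a b c .{{_ : NonZero b}} → a ≤ c * b → ↥ (+ a ℚ./ b) ℤ.≤ + c ℤ.* ↧ (+ a ℚ./ b)
fraction≤ a (suc b) c a≤cb =
  cross-≤ (sym (↥/-cross (+ a) (suc b))) (+ c) (subst (+ a ℤ.≤_) (ℤ.pos-* c (suc b)) (ℤ.+≤+ a≤cb))

fraction> : ∀ a b c .{{_ : NonZero b}} → c * b < a → + c ℤ.* ↧ (+ a ℚ./ b) ℤ.< ↥ (+ a ℚ./ b)
fraction> a (suc b) c cb<a =
  cross-< (sym (↥/-cross (+ a) (suc b))) (+ c) (subst (ℤ._< + a) (ℤ.pos-* c (suc b)) (ℤ.+<+ cb<a))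

lower-bound-mono : ∀ {p q} c → c ℤ.* ↧ p ℤ.< ↥ p → p ℚ.≤ q → c ℤ.* ↧ q ℤ.< ↥ q
lower-bound-mono {p} {q} c cp<p p≤q = ℤ.*-cancelʳ-<-nonNeg (↧ p) (begin-strict
  c ℤ.* ↧ q ℤ.* ↧ p   ≡⟨ ℤ*.xy∙z≈xz∙y c (↧ q) (↧ p) ⟩
  c ℤ.* ↧ p ℤ.* ↧ q   <⟨ ℤ.*-monoʳ-<-pos (↧ q) cp<p ⟩
  ↥ p ℤ.* ↧ q         ≤⟨ ℚ.drop-*≤* p≤q ⟩
  ↥ q ℤ.* ↧ p         ∎)
  where open ℤ.≤-Reasoning

mad-ceiling : ∀ {G m} k → IsMad G m → (∀ H → 2 * ∣E∣ H ≤ 2 * suc k * ∣V∣ H) →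
              (H : Subgraph G) (nz : NonZero (∣V∣ H)) → 2 * k * ∣V∣ H < 2 * ∣E∣ H →
              ceiling (m *ℚ ½) ≡ + suc k
mad-ceiling {m = m} k ((H₀ , nz₀ , avg≡m) , maximal) sparse H nz dense = ceiling-half m k
  (lower-bound-mono (+ (2 * k)) (fraction> (2 * ∣E∣ H) (∣V∣ H) (2 * k) {{nz}} dense) (maximal H nz))
  (subst (λ q → ↥ q ℤ.≤ + (2 * suc k) ℤ.* ↧ q) avg≡m
         (fraction≤ (2 * ∣E∣ H₀) (∣V∣ H₀) (2 * suc k) {{nz₀}} (sparse H₀)))

-- The vertices of G(k,r)

=ᶠ-refl : ∀ {m} (i : Fin m) → (i =ᶠ i) ≡ true
=ᶠ-refl i = dec-true (i Fin.≟ i) refl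

=ᶠ-≢ : ∀ {m} {i j : Fin m} → i ≢ j → (i =ᶠ j) ≡ false
=ᶠ-≢ {i = i} {j} = dec-false (i Fin.≟ j)

=ᶠ⇒≡ : ∀ {m} {i j : Fin m} → (i =ᶠ j) ≡ true → i ≡ j
=ᶠ⇒≡ {i = i} {j} e with i Fin.≟ j
... | yes i≡j = i≡j

=ᶠ-sym : ∀ {m} (i j : Fin m) → (i =ᶠ j) ≡ (j =ᶠ i)
=ᶠ-sym i j with i Fin.≟ j
... | yes i≡j = sym (dec-true (j Fin.≟ i) (sym i≡j))
... | no  i≢j = sym (dec-false (j Fin.≟ i) (i≢j ∘ sym))

sum-δ : ∀ {n} (i : Fin n) (f : Fin n → ℕ) → ∑[ j < n ] (⟦ i =ᶠ j ⟧ * f j) ≡ f i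
sum-δ i f = trans (sum-supported-at i λ j j≢i → cong (λ b → ⟦ b ⟧ * f j) (=ᶠ-≢ (j≢i ∘ sym)))
                  (trans (cong (λ b → ⟦ b ⟧ * f i) (=ᶠ-refl i)) (+-identityʳ (f i)))

sum-≢ : ∀ {n} (i : Fin n) → ∑[ j < n ] ⟦ not (i =ᶠ j) ⟧ ≡ n ∸ 1
sum-≢ {n} i = sym (trans (cong (_∸ 1) all) (m+n∸n≡m _ 1))
  where
  split : ∀ b → ⟦ not b ⟧ + ⟦ b ⟧ * 1 ≡ 1
  split true  = refl
  split false = refl
  all : n ≡ ∑[ j < n ] ⟦ not (i =ᶠ j) ⟧ + 1
  all = begin
    n
      ≡⟨ trans (sum-const n 1) (*-identityʳ n) ⟨
    ∑[ j < n ] 1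
      ≡⟨ sum-cong-≗ (split ∘ (i =ᶠ_)) ⟨
    ∑[ j < n ] (⟦ not (i =ᶠ j) ⟧ + ⟦ i =ᶠ j ⟧ * 1)
      ≡⟨ ∑-distrib-+ (⟦_⟧ ∘ not ∘ (i =ᶠ_)) (λ j → ⟦ i =ᶠ j ⟧ * 1) ⟩
    ∑[ j < n ] ⟦ not (i =ᶠ j) ⟧ + ∑[ j < n ] (⟦ i =ᶠ j ⟧ * 1)
      ≡⟨ cong (_+_ (∑[ j < n ] ⟦ not (i =ᶠ j) ⟧)) (sum-δ i (λ _ → 1)) ⟩
    ∑[ j < n ] ⟦ not (i =ᶠ j) ⟧ + 1
      ∎
    where open ≡-Reasoning

module _ (k r : ℕ) where

  Vertex : Set
  Vertex = Fin r × Role k r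

  private
    nB = (2 ^ k ∸ 1) * sizeBS k r
    nC = nBlocks k r * k

  roleIndex : Role k r → Fin (N₁ k r)
  roleIndex (roleA a)   = a ↑ˡ _
  roleIndex (roleB S j) = k ↑ʳ (combine S j ↑ˡ _)
  roleIndex (roleC i t) = k ↑ʳ (nB ↑ʳ (combine i t ↑ˡ _))
  roleIndex (roleD d)   = k ↑ʳ (nB ↑ʳ (nC ↑ʳ d))

  decodeRole-roleIndex : ∀ ρ → decodeRole k r (roleIndex ρ) ≡ ρ
  decodeRole-roleIndex (roleA a)
    rewrite splitAt-↑ˡ k a (nB + (nC + nBlocks k r)) = refl
  decodeRole-roleIndex (roleB S j)
    rewrite splitAt-↑ʳ k (nB + (nC + nBlocks k r)) (combine S j ↑ˡ (nC + nBlocks k r))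
          | splitAt-↑ˡ nB (combine S j) (nC + nBlocks k r)
    = cong (λ (S , j) → roleB S j) (remQuot-combine S j)
  decodeRole-roleIndex (roleC i t)
    rewrite splitAt-↑ʳ k (nB + (nC + nBlocks k r)) (nB ↑ʳ (combine i t ↑ˡ nBlocks k r))
          | splitAt-↑ʳ nB (nC + nBlocks k r) (combine i t ↑ˡ nBlocks k r)
          | splitAt-↑ˡ nC (combine i t) (nBlocks k r)
    = cong (λ (i , t) → roleC i t) (remQuot-combine i t)
  decodeRole-roleIndex (roleD d)
    rewrite splitAt-↑ʳ k (nB + (nC + nBlocks k r)) (nB ↑ʳ (nC ↑ʳ d))
          | splitAt-↑ʳ nB (nC + nBlocks k r) (nC ↑ʳ d)
          | splitAt-↑ʳ nC (nBlocks k r) d = refl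

  vertex : Vertex → Fin (r * N₁ k r)
  vertex (s , ρ) = combine s (roleIndex ρ)

  decode-vertex : ∀ p → decode k r (vertex p) ≡ p
  decode-vertex (s , ρ) =
    trans (cong (λ (s , w) → s , decodeRole k r w) (remQuot-combine s (roleIndex ρ)))
          (cong (s ,_) (decodeRole-roleIndex ρ))

  ∑ᴬ ∑ᴮ ∑ᶜ ∑ᴰ ∑ᴿ : (Role k r → ℕ) → ℕ
  ∑ᴬ g = ∑[ a < k ] g (roleA a)
  ∑ᴮ g = ∑[ S < 2 ^ k ∸ 1 ] ∑[ j < sizeBS k r ] g (roleB S j)
  ∑ᶜ g = ∑[ i < nBlocks k r ] ∑[ t < k ] g (roleC i t)
  ∑ᴰ g = ∑[ d < nBlocks k r ] g (roleD d)
  ∑ᴿ g = ∑ᴬ g + (∑ᴮ g + (∑ᶜ g + ∑ᴰ g))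

  ∑ⱽ : (Vertex → ℕ) → ℕ
  ∑ⱽ g = ∑[ s < r ] ∑ᴿ (λ ρ → g (s , ρ))

  ∑ᴿ-cong : ∀ {g h : Role k r → ℕ} → (∀ ρ → g ρ ≡ h ρ) → ∑ᴿ g ≡ ∑ᴿ h
  ∑ᴿ-cong e =
    cong₂ _+_ (sum-cong-≗ (e ∘ roleA)) (cong₂ _+_ (sum-cong-≗ λ S → sum-cong-≗ (e ∘ roleB S))
    (cong₂ _+_ (sum-cong-≗ λ i → sum-cong-≗ (e ∘ roleC i)) (sum-cong-≗ (e ∘ roleD))))

  ∑ᴿ-mono-≤ : ∀ {g h : Role k r → ℕ} → (∀ ρ → g ρ ≤ h ρ) → ∑ᴿ g ≤ ∑ᴿ h
  ∑ᴿ-mono-≤ g≤h =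
    +-mono-≤ (sum-mono-≤ (g≤h ∘ roleA)) (+-mono-≤ (sum-mono-≤ λ S → sum-mono-≤ (g≤h ∘ roleB S))
    (+-mono-≤ (sum-mono-≤ λ i → sum-mono-≤ (g≤h ∘ roleC i)) (sum-mono-≤ (g≤h ∘ roleD))))

  ∑ⱽ-cong : ∀ {g h : Vertex → ℕ} → (∀ p → g p ≡ h p) → ∑ⱽ g ≡ ∑ⱽ h
  ∑ⱽ-cong e = sum-cong-≗ λ s → ∑ᴿ-cong (e ∘ (s ,_))

  ∑ⱽ-mono-≤ : ∀ {g h : Vertex → ℕ} → (∀ p → g p ≤ h p) → ∑ⱽ g ≤ ∑ⱽ h
  ∑ⱽ-mono-≤ g≤h = sum-mono-≤ λ s → ∑ᴿ-mono-≤ (g≤h ∘ (s ,_))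

  ∑ᴿ-onlyA : ∀ (g : Role k r → ℕ) → (∀ S j → g (roleB S j) ≡ 0) → (∀ i t → g (roleC i t) ≡ 0) →
             (∀ d → g (roleD d) ≡ 0) → ∑ᴿ g ≡ ∑ᴬ g
  ∑ᴿ-onlyA g B≡0 C≡0 D≡0 =
    trans (cong (_+_ (∑ᴬ g)) (cong₂ _+_ (sum-zero λ S → sum-zero (B≡0 S))
                           (cong₂ _+_ (sum-zero λ i → sum-zero (C≡0 i)) (sum-zero D≡0))))
          (+-identityʳ _)

  ∑ᴿ-onlyC : ∀ (g : Role k r → ℕ) → (∀ a → g (roleA a) ≡ 0) → (∀ S j → g (roleB S j) ≡ 0) →
             (∀ d → g (roleD d) ≡ 0) → ∑ᴿ g ≡ ∑ᶜ g
  ∑ᴿ-onlyC g A≡0 B≡0 D≡0 =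
    cong₂ _+_ (sum-zero A≡0) (cong₂ _+_ (sum-zero λ S → sum-zero (B≡0 S))
                             (trans (cong (_+_ (∑ᶜ g)) (sum-zero D≡0)) (+-identityʳ _)))

  ∑ᴿ-zero : ∑ᴿ (λ _ → 0) ≡ 0
  ∑ᴿ-zero = trans (∑ᴿ-onlyA (λ _ → 0) (λ _ _ → refl) (λ _ _ → refl) (λ _ → refl)) (sum-zero {k} λ _ → refl)

  ∑ⱽ-zero : ∑ⱽ (λ _ → 0) ≡ 0
  ∑ⱽ-zero = sum-zero {r} λ _ → ∑ᴿ-zero

  ∑ⱽ-copy : ∀ {g : Vertex → ℕ} s → (∀ s′ ρ → s′ ≢ s → g (s′ , ρ) ≡ 0) →
            ∑ⱽ g ≡ ∑ᴿ (λ ρ → g (s , ρ))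
  ∑ⱽ-copy s g≡0 = sum-supported-at s λ s′ s′≢s → trans (∑ᴿ-cong λ ρ → g≡0 s′ ρ s′≢s) ∑ᴿ-zero

  onA : (Fin r → Fin k → ℕ) → Vertex → ℕ
  onA f (s , roleA a)   = f s a
  onA f (s , roleB _ _) = 0
  onA f (s , roleC _ _) = 0
  onA f (s , roleD _)   = 0

  ∑ⱽ-onA : ∀ f → ∑ⱽ (onA f) ≡ ∑[ s < r ] ∑[ a < k ] f s a
  ∑ⱽ-onA f = sum-cong-≗ {r} λ s → ∑ᴿ-onlyA (λ ρ → onA f (s , ρ)) (λ _ _ → refl) (λ _ _ → refl) (λ _ → refl)

  onC : (Fin r → Fin (nBlocks k r) → Fin k → ℕ) → Vertex → ℕ
  onC f (s , roleA _)   = 0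
  onC f (s , roleB _ _) = 0
  onC f (s , roleC i t) = f s i t
  onC f (s , roleD _)   = 0

  ∑ⱽ-onC : ∀ f → ∑ⱽ (onC f) ≡ ∑[ s < r ] ∑[ i < nBlocks k r ] ∑[ t < k ] f s i t
  ∑ⱽ-onC f = sum-cong-≗ {r} λ s → ∑ᴿ-onlyC (λ ρ → onC f (s , ρ)) (λ _ → refl) (λ _ _ → refl) (λ _ → refl)

  ∑ⱽ-copyA : ∀ s (f : Fin k → ℕ) → ∑ⱽ (onA λ s′ a → ⟦ s =ᶠ s′ ⟧ * f a) ≡ ∑[ a < k ] f a
  ∑ⱽ-copyA s f = begin
    ∑ⱽ (onA λ s′ a → ⟦ s =ᶠ s′ ⟧ * f a)        ≡⟨ ∑ⱽ-onA _ ⟩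
    ∑[ s′ < r ] ∑[ a < k ] (⟦ s =ᶠ s′ ⟧ * f a) ≡⟨ ∑-comm (λ s′ a → ⟦ s =ᶠ s′ ⟧ * f a) ⟩
    ∑[ a < k ] ∑[ s′ < r ] (⟦ s =ᶠ s′ ⟧ * f a) ≡⟨ sum-cong-≗ {k} (λ a → sum-δ s (λ _ → f a)) ⟩
    ∑[ a < k ] f a                              ∎
    where open ≡-Reasoning

  ∑ⱽ-copyC : ∀ s (f : Fin (nBlocks k r) → Fin k → ℕ) →
             ∑ⱽ (onC λ s′ i t → ⟦ s =ᶠ s′ ⟧ * f i t) ≡ ∑[ i < nBlocks k r ] ∑[ t < k ] f i t
  ∑ⱽ-copyC s f = begin
    ∑ⱽ (onC λ s′ i t → ⟦ s =ᶠ s′ ⟧ * f i t)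
      ≡⟨ ∑ⱽ-onC _ ⟩
    ∑[ s′ < r ] ∑[ i < nBlocks k r ] ∑[ t < k ] (⟦ s =ᶠ s′ ⟧ * f i t)
      ≡⟨ sum-cong-≗ {r} (λ s′ → trans (*-distribˡ-sum ⟦ s =ᶠ s′ ⟧ (λ i → ∑[ t < k ] f i t))
                                      (sum-cong-≗ {nBlocks k r} λ i → *-distribˡ-sum ⟦ s =ᶠ s′ ⟧ (f i))) ⟨
    ∑[ s′ < r ] (⟦ s =ᶠ s′ ⟧ * ∑[ i < nBlocks k r ] ∑[ t < k ] f i t)
      ≡⟨ sum-δ s _ ⟩
    ∑[ i < nBlocks k r ] ∑[ t < k ] f i t
      ∎
    where open ≡-Reasoning

  ∑ᴮ≤∑ⱽ : ∀ (g : Vertex → ℕ) s S → ∑[ j < sizeBS k r ] g (s , roleB S j) ≤ ∑ⱽ g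
  ∑ᴮ≤∑ⱽ g s S = begin
    ∑[ j < sizeBS k r ] g (s , roleB S j)  ≤⟨ term≤sum (λ S → ∑[ j < sizeBS k r ] g (s , roleB S j)) S ⟩
    ∑ᴮ gₛ                                  ≤⟨ m≤m+n (∑ᴮ gₛ) (∑ᶜ gₛ + ∑ᴰ gₛ) ⟩
    ∑ᴮ gₛ + (∑ᶜ gₛ + ∑ᴰ gₛ)                 ≤⟨ m≤n+m _ (∑ᴬ gₛ) ⟩
    ∑ᴿ gₛ                                  ≤⟨ term≤sum (λ s → ∑ᴿ (λ ρ → g (s , ρ))) s ⟩
    ∑ⱽ g                                   ∎
    where
    open ≤-Reasoning
    gₛ = λ ρ → g (s , ρ)

  ∑ᶜ≤∑ⱽ : ∀ (g : Vertex → ℕ) s → ∑ᶜ (λ ρ → g (s , ρ)) ≤ ∑ⱽ g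
  ∑ᶜ≤∑ⱽ g s = begin
    ∑ᶜ gₛ                    ≤⟨ m≤m+n (∑ᶜ gₛ) (∑ᴰ gₛ) ⟩
    ∑ᶜ gₛ + ∑ᴰ gₛ            ≤⟨ m≤n+m _ (∑ᴮ gₛ) ⟩
    ∑ᴮ gₛ + (∑ᶜ gₛ + ∑ᴰ gₛ)  ≤⟨ m≤n+m _ (∑ᴬ gₛ) ⟩
    ∑ᴿ gₛ                    ≤⟨ term≤sum (λ s → ∑ᴿ (λ ρ → g (s , ρ))) s ⟩
    ∑ⱽ g                     ∎
    where
    open ≤-Reasoning
    gₛ = λ ρ → g (s , ρ)

  sum≡∑ⱽ : (f : Fin (r * N₁ k r) → ℕ) → sum f ≡ ∑ⱽ (f ∘ vertex)
  sum≡∑ⱽ f = trans (sum-combine r (N₁ k r) f) (sum-cong-≗ λ (s : Fin r) → sumRole (f ∘ combine s))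
    where
    sumRole : (h : Fin (N₁ k r) → ℕ) → sum h ≡ ∑ᴿ (h ∘ roleIndex)
    sumRole h =
      trans (sum-↑ k {nB + (nC + nBlocks k r)} h) (cong (_+_ (∑ᴬ (h ∘ roleIndex)))
      (trans (sum-↑ nB _) (cong₂ _+_ (sum-combine (2 ^ k ∸ 1) (sizeBS k r) _)
      (trans (sum-↑ nC _) (cong (_+ ∑ᴰ (h ∘ roleIndex)) (sum-combine (nBlocks k r) k _))))))

  sum-decode : (g : Vertex → ℕ) → ∑[ v < r * N₁ k r ] g (decode k r v) ≡ ∑ⱽ g
  sum-decode g = trans (sum≡∑ⱽ (g ∘ decode k r)) (∑ⱽ-cong (cong g ∘ decode-vertex))

isA : ∀ {k r} → Role k r → Bool
isA (roleA _)   = true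
isA (roleB _ _) = false
isA (roleC _ _) = false
isA (roleD _)   = false

module _ {k r : ℕ} (U : Fin r → Subset k) where

  adj-vertex : ∀ p q → adj (Gkr k r U) (vertex k r p) (vertex k r q) ≡ adjR k r U p q
  adj-vertex p q rewrite decode-vertex k r p | decode-vertex k r q = refl

  adjR-sym : ∀ p q → adjR k r U p q ≡ adjR k r U q p
  adjR-sym (s , roleA x)   (s′ , roleA y)   rewrite =ᶠ-sym s s′ = cong (not (s′ =ᶠ s) ∧_) (∧-comm (lookup (U s) x) _)
  adjR-sym (s , roleA x)   (s′ , roleB S j) rewrite =ᶠ-sym s s′ = refl
  adjR-sym (s , roleA x)   (s′ , roleC i t) = =ᶠ-sym s s′
  adjR-sym (s , roleA x)   (s′ , roleD d)   = refl
  adjR-sym (s , roleB S j) (s′ , roleA x)   rewrite =ᶠ-sym s s′ = refl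
  adjR-sym (s , roleB S j) (s′ , roleB _ _) = refl
  adjR-sym (s , roleB S j) (s′ , roleC _ _) = refl
  adjR-sym (s , roleB S j) (s′ , roleD _)   = refl
  adjR-sym (s , roleC i t) (s′ , roleA x)   = =ᶠ-sym s s′
  adjR-sym (s , roleC i t) (s′ , roleB _ _) = refl
  adjR-sym (s , roleC i t) (s′ , roleC _ _) = refl
  adjR-sym (s , roleC i t) (s′ , roleD d)   rewrite =ᶠ-sym s s′ = refl
  adjR-sym (s , roleD d)   (s′ , roleA _)   = refl
  adjR-sym (s , roleD d)   (s′ , roleB _ _) = refl
  adjR-sym (s , roleD d)   (s′ , roleC i t) rewrite =ᶠ-sym s s′ = refl
  adjR-sym (s , roleD d)   (s′ , roleD _)   = refl

  adjR-other-copy : ∀ {s s′} ρ ρ′ → isA ρ ≡ false → s′ ≢ s → adjR k r U (s , ρ) (s′ , ρ′) ≡ false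
  adjR-other-copy {s} {s′} (roleB _ _) (roleA _)   _ s′≢s rewrite =ᶠ-≢ (s′≢s ∘ sym) = refl
  adjR-other-copy {s} {s′} (roleC _ _) (roleA _)   _ s′≢s = =ᶠ-≢ (s′≢s ∘ sym)
  adjR-other-copy {s} {s′} (roleC _ _) (roleD _)   _ s′≢s rewrite =ᶠ-≢ (s′≢s ∘ sym) = refl
  adjR-other-copy {s} {s′} (roleD _)   (roleC _ _) _ s′≢s rewrite =ᶠ-≢ (s′≢s ∘ sym) = refl
  adjR-other-copy (roleB _ _) (roleB _ _) _ _ = refl
  adjR-other-copy (roleB _ _) (roleC _ _) _ _ = refl
  adjR-other-copy (roleB _ _) (roleD _)   _ _ = refl
  adjR-other-copy (roleC _ _) (roleB _ _) _ _ = refl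
  adjR-other-copy (roleC _ _) (roleC _ _) _ _ = refl
  adjR-other-copy (roleD _)   (roleA _)   _ _ = refl
  adjR-other-copy (roleD _)   (roleB _ _) _ _ = refl
  adjR-other-copy (roleD _)   (roleD _)   _ _ = refl

  adj-sym : ∀ u v → adj (Gkr k r U) u v ≡ adj (Gkr k r U) v u
  adj-sym u v = adjR-sym (decode k r u) (decode k r v)

-- Subsets of A

∣p∣≡sum : ∀ {n} (p : Subset n) → ∣ p ∣ ≡ ∑[ i < n ] ⟦ lookup p i ⟧
∣p∣≡sum []          = refl
∣p∣≡sum (true  ∷ p) = cong suc (∣p∣≡sum p)
∣p∣≡sum (false ∷ p) = ∣p∣≡sum p

initialSegment : ∀ n → ℕ → Subset n
initialSegment zero    m       = []
initialSegment (suc n) zero    = ∅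
initialSegment (suc n) (suc m) = true ∷ initialSegment n m

∣initialSegment∣ : ∀ {n m} → m ≤ n → ∣ initialSegment n m ∣ ≡ m
∣initialSegment∣ {zero}  z≤n       = refl
∣initialSegment∣ {suc n} z≤n       = ∣⊥∣≡0 (suc n)
∣initialSegment∣ {suc n} (s≤s m≤n) = cong suc (∣initialSegment∣ m≤n)

subset-containing : ∀ {n} (x : Fin n) {j} → 1 ≤ j → j ≤ n →
                    ∃ λ T → lookup T x ≡ true × ∣ T ∣ ≡ j
subset-containing zero {suc j} _ (s≤s j≤n) =
  true ∷ initialSegment _ j , refl , cong suc (∣initialSegment∣ j≤n)
subset-containing {suc n} (suc x) {j} 1≤j j≤1+n with j ≤? n
... | yes j≤n = let T , x∈T , ∣T∣≡j = subset-containing x 1≤j j≤n in false ∷ T , x∈T , ∣T∣≡j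
... | no  j≰n = ⊤ , lookup-replicate x true , trans (∣⊤∣≡n (suc n)) (≤-antisym (≰⇒> j≰n) j≤1+n)

binary : ∀ {n} → Subset n → ℕ
binary []      = 0
binary (b ∷ T) = ⟦ b ⟧ + binary T * 2

bits-binary : ∀ {n} (T : Subset n) → bits (binary T) n ≡ T
bits-binary []      = refl
bits-binary (b ∷ T) = cong₂ _∷_ (lowest-bit b) (trans (cong (λ m → bits m _) (shift b)) (bits-binary T))
  where
  lowest-bit : ∀ b → ((⟦ b ⟧ + binary T * 2) % 2 ≡ᵇ 1) ≡ b
  lowest-bit true  = cong (_≡ᵇ 1) ([m+kn]%n≡m%n 1 (binary T) 2)
  lowest-bit false = cong (_≡ᵇ 1) ([m+kn]%n≡m%n 0 (binary T) 2)
  shift : ∀ b → (⟦ b ⟧ + binary T * 2) / 2 ≡ binary T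
  shift b = trans (+-distrib-/-∣ʳ ⟦ b ⟧ (divides-refl (binary T)))
                  (cong₂ _+_ (m<n⇒m/n≡0 (s≤s (⟦⟧≤1 b))) (m*n/n≡m (binary T) 2))

binary<2^n : ∀ {n} (T : Subset n) → binary T < 2 ^ n
binary<2^n []              = s≤s z≤n
binary<2^n {suc n} (b ∷ T) = begin-strict
  ⟦ b ⟧ + binary T * 2  <⟨ +-monoˡ-< (binary T * 2) (s≤s (⟦⟧≤1 b)) ⟩
  suc (binary T) * 2    ≤⟨ *-monoˡ-≤ 2 (binary<2^n T) ⟩
  2 ^ n * 2             ≡⟨ *-comm (2 ^ n) 2 ⟩
  2 ^ suc n             ∎
  where open ≤-Reasoning

binary-pos : ∀ {n} (T : Subset n) {x} → lookup T x ≡ true → 1 ≤ binary T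
binary-pos (true ∷ T) {zero}  _   = s≤s z≤n
binary-pos (b    ∷ T) {suc x} x∈T = ≤-trans (binary-pos T x∈T) (≤-trans (m≤m*n (binary T) 2) (m≤n+m _ ⟦ b ⟧))

subsetOf-onto : ∀ {k} (T : Subset k) {x} → lookup T x ≡ true → ∃ λ S → subsetOf S ≡ T
subsetOf-onto {k} T x∈T = fromℕ< index<size , trans (cong (λ m → bits m k) suc-index) (bits-binary T)
  where
  index<size : binary T ∸ 1 < 2 ^ k ∸ 1
  index<size = ∸-monoˡ-< (binary<2^n T) (binary-pos T x∈T)
  suc-index : suc (toℕ (fromℕ< index<size)) ≡ binary T
  suc-index = trans (cong suc (toℕ-fromℕ< index<size)) (trans (+-comm 1 _) (m∸n+n≡m (binary-pos T x∈T)))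

-- Maximum average degree of G(k,r)

module _ {k r : ℕ} (U : Fin r → Subset k) where

  charge : Role k r → Role k r → ℕ
  charge (roleA _)   (roleA _)   = 1
  charge (roleB _ _) (roleA _)   = 2
  charge (roleC _ _) (roleA _)   = 2
  charge (roleD _)   (roleC _ _) = 2
  charge _           _           = 0

  charge-edge : ∀ p q → adjR k r U p q ≡ true → charge (proj₂ p) (proj₂ q) + charge (proj₂ q) (proj₂ p) ≡ 2
  charge-edge (_ , roleA _)   (_ , roleA _)   e = refl
  charge-edge (_ , roleA _)   (_ , roleB _ _) e = refl
  charge-edge (_ , roleA _)   (_ , roleC _ _) e = refl
  charge-edge (_ , roleB _ _) (_ , roleA _)   e = refl
  charge-edge (_ , roleC _ _) (_ , roleA _)   e = refl
  charge-edge (_ , roleC _ _) (_ , roleD _)   e = refl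
  charge-edge (_ , roleD _)   (_ , roleC _ _) e = refl
  charge-edge (_ , roleA _)   (_ , roleD _)   ()
  charge-edge (_ , roleB _ _) (_ , roleB _ _) ()
  charge-edge (_ , roleB _ _) (_ , roleC _ _) ()
  charge-edge (_ , roleB _ _) (_ , roleD _)   ()
  charge-edge (_ , roleC _ _) (_ , roleB _ _) ()
  charge-edge (_ , roleC _ _) (_ , roleC _ _) ()
  charge-edge (_ , roleD _)   (_ , roleA _)   ()
  charge-edge (_ , roleD _)   (_ , roleB _ _) ()
  charge-edge (_ , roleD _)   (_ , roleD _)   ()

  received : Vertex k r → Vertex k r → ℕ
  received p q = charge (proj₂ p) (proj₂ q) * ⟦ adjR k r U p q ⟧

  module _ {u : ℕ} (∣U∣≡u : ∀ s → ∣ U s ∣ ≡ u) where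

    U-size : ∀ s → ∑[ x < k ] ⟦ lookup (U s) x ⟧ ≡ u
    U-size s = trans (sym (∣p∣≡sum (U s))) (∣U∣≡u s)

    U-other-copies : ∀ s → ∑[ s′ < r ] ∑[ y < k ] (⟦ not (s =ᶠ s′) ⟧ * ⟦ lookup (U s′) y ⟧) ≡ (r ∸ 1) * u
    U-other-copies s = begin
      ∑[ s′ < r ] ∑[ y < k ] (⟦ not (s =ᶠ s′) ⟧ * ⟦ lookup (U s′) y ⟧)
        ≡⟨ sum-cong-≗ {r} (λ s′ → *-distribˡ-sum ⟦ not (s =ᶠ s′) ⟧ (⟦_⟧ ∘ lookup (U s′))) ⟨
      ∑[ s′ < r ] (⟦ not (s =ᶠ s′) ⟧ * ∑[ y < k ] ⟦ lookup (U s′) y ⟧)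
        ≡⟨ sum-cong-≗ {r} (λ s′ → cong (⟦ not (s =ᶠ s′) ⟧ *_) (U-size s′)) ⟩
      ∑[ s′ < r ] (⟦ not (s =ᶠ s′) ⟧ * u)
        ≡⟨ *-distribʳ-sum u (⟦_⟧ ∘ not ∘ (s =ᶠ_)) ⟨
      ∑[ s′ < r ] ⟦ not (s =ᶠ s′) ⟧ * u
        ≡⟨ cong (_* u) (sum-≢ s) ⟩
      (r ∸ 1) * u
        ∎
      where open ≡-Reasoning

  module _ {u : ℕ} (∣U∣≡u : ∀ s → ∣ U s ∣ ≡ u) (U-small : (r ∸ 1) * u ≤ 2 * k) where

    private
      own-copy-A : ∀ s → ∑ⱽ k r (onA k r λ s′ _ → ⟦ s =ᶠ s′ ⟧ * 2) ≡ 2 * k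
      own-copy-A s = trans (∑ⱽ-copyA k r s (λ _ → 2)) (trans (sum-const k 2) (*-comm k 2))

    received-A≤ : ∀ s x → ∑ⱽ k r (received (s , roleA x)) ≤ 2 * k
    received-A≤ s x = begin
      ∑ⱽ k r (received (s , roleA x))
        ≤⟨ ∑ⱽ-mono-≤ k r bound ⟩
      ∑ⱽ k r (onA k r λ s′ y → ⟦ not (s =ᶠ s′) ⟧ * ⟦ lookup (U s′) y ⟧)
        ≡⟨ trans (∑ⱽ-onA k r _) (U-other-copies ∣U∣≡u s) ⟩
      (r ∸ 1) * u
        ≤⟨ U-small ⟩
      2 * k
        ∎
      where
      open ≤-Reasoning
      bound : ∀ q → received (s , roleA x) q ≤ onA k r (λ s′ y → ⟦ not (s =ᶠ s′) ⟧ * ⟦ lookup (U s′) y ⟧) q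
      bound (s′ , roleA y) with not (s =ᶠ s′) | lookup (U s) x
      ... | true  | true  = ≤-refl
      ... | true  | false = z≤n
      ... | false | _     = z≤n
      bound (s′ , roleB _ _) = z≤n
      bound (s′ , roleC _ _) = z≤n
      bound (s′ , roleD _)   = z≤n

    received-D≤ : ∀ s d → ∑ⱽ k r (received (s , roleD d)) ≤ 2 * k
    received-D≤ s d = begin
      ∑ⱽ k r (received (s , roleD d))
        ≤⟨ ∑ⱽ-mono-≤ k r bound ⟩
      ∑ⱽ k r (onC k r λ s′ i _ → ⟦ s =ᶠ s′ ⟧ * (⟦ d =ᶠ i ⟧ * 2))
        ≡⟨ ∑ⱽ-copyC k r s (λ i _ → ⟦ d =ᶠ i ⟧ * 2) ⟩
      ∑[ i < nBlocks k r ] ∑[ t < k ] (⟦ d =ᶠ i ⟧ * 2)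
        ≡⟨ sum-cong-≗ {nBlocks k r} (λ i → *-distribˡ-sum ⟦ d =ᶠ i ⟧ (λ (_ : Fin k) → 2)) ⟨
      ∑[ i < nBlocks k r ] (⟦ d =ᶠ i ⟧ * ∑[ t < k ] 2)
        ≡⟨ sum-δ d _ ⟩
      ∑[ t < k ] 2
        ≡⟨ trans (sum-const k 2) (*-comm k 2) ⟩
      2 * k
        ∎
      where
      open ≤-Reasoning
      bound : ∀ q → received (s , roleD d) q ≤ onC k r (λ s′ i _ → ⟦ s =ᶠ s′ ⟧ * (⟦ d =ᶠ i ⟧ * 2)) q
      bound (s′ , roleC i t) rewrite =ᶠ-sym d i with s =ᶠ s′ | i =ᶠ d
      ... | true  | true  = ≤-refl
      ... | true  | false = z≤n
      ... | false | _     = z≤n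
      bound (s′ , roleA _)   = z≤n
      bound (s′ , roleB _ _) = z≤n
      bound (s′ , roleD _)   = z≤n

    received≤2k : ∀ p → ∑ⱽ k r (received p) ≤ 2 * k
    received≤2k (s , roleA x)   = received-A≤ s x
    received≤2k (s , roleB S j) = ≤-trans (∑ⱽ-mono-≤ k r bound) (≤-reflexive (own-copy-A s))
      where
      bound : ∀ q → received (s , roleB S j) q ≤ onA k r (λ s′ _ → ⟦ s =ᶠ s′ ⟧ * 2) q
      bound (s′ , roleA y) with s =ᶠ s′
      ... | true  = *-monoʳ-≤ 2 (⟦⟧≤1 (lookup (subsetOf S) y))
      ... | false = z≤n
      bound (s′ , roleB _ _) = z≤n
      bound (s′ , roleC _ _) = z≤n
      bound (s′ , roleD _)   = z≤n
    received≤2k (s , roleC i t) = ≤-trans (∑ⱽ-mono-≤ k r bound) (≤-reflexive (own-copy-A s))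
      where
      bound : ∀ q → received (s , roleC i t) q ≤ onA k r (λ s′ _ → ⟦ s =ᶠ s′ ⟧ * 2) q
      bound (s′ , roleA y)   = ≤-reflexive (*-comm 2 ⟦ s =ᶠ s′ ⟧)
      bound (s′ , roleB _ _) = z≤n
      bound (s′ , roleC _ _) = z≤n
      bound (s′ , roleD _)   = z≤n
    received≤2k (s , roleD d)   = received-D≤ s d

    2∣E∣≤2k∣V∣ : (H : Subgraph (Gkr k r U)) → 2 * ∣E∣ H ≤ 2 * k * ∣V∣ H
    2∣E∣≤2k∣V∣ = discharging (λ v w → charge (proj₂ (decode k r v)) (proj₂ (decode k r w)))
                             (λ v w → charge-edge (decode k r v) (decode k r w))
                             (λ v → ≤-trans (≤-reflexive (sum-decode k r (received (decode k r v))))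
                                            (received≤2k (decode k r v)))

  module _ (s₀ : Fin r) where

    inA inC : Vertex k r → Bool
    inA (s , roleA _)   = s₀ =ᶠ s
    inA (s , roleB _ _) = false
    inA (s , roleC _ _) = false
    inA (s , roleD _)   = false
    inC (s , roleA _)   = false
    inC (s , roleB _ _) = false
    inC (s , roleC _ _) = s₀ =ᶠ s
    inC (s , roleD _)   = false

    private
      same-copy : ∀ {s s′} → (s₀ =ᶠ s) ≡ true → (s₀ =ᶠ s′) ≡ true → (s =ᶠ s′) ≡ true
      same-copy {s} {s′} e e′ with =ᶠ⇒≡ {i = s₀} {s} e | =ᶠ⇒≡ {i = s₀} {s′} e′
      ... | refl | refl = =ᶠ-refl s₀

      disjoint : ∀ p → inA p ≡ true → inC p ≡ false
      disjoint (s , roleA _) _ = refl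

      complete : ∀ p q → inA p ≡ true → inC q ≡ true → adjR k r U p q ≡ true
      complete (s , roleA _) (s′ , roleC _ _) = same-copy

      A-independent : ∀ p q → inA p ≡ true → inA q ≡ true → adjR k r U p q ≡ false
      A-independent (s , roleA _) (s′ , roleA _) e e′ rewrite same-copy e e′ = refl

      C-independent : ∀ p q → inC p ≡ true → inC q ≡ true → adjR k r U p q ≡ false
      C-independent (s , roleC _ _) (s′ , roleC _ _) _ _ = refl

      countF-decode : (X : Vertex k r → Bool) → countF (X ∘ decode k r) ≡ ∑ⱽ k r (⟦_⟧ ∘ X)
      countF-decode X = trans (countF≡sum (X ∘ decode k r)) (sum-decode k r (⟦_⟧ ∘ X))

      ∣A∣ : countF (inA ∘ decode k r) ≡ k
      ∣A∣ = trans (countF-decode inA) (trans (∑ⱽ-cong k r pointwise)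
              (trans (∑ⱽ-copyA k r s₀ (λ _ → 1)) (trans (sum-const k 1) (*-identityʳ k))))
        where
        pointwise : ∀ p → ⟦ inA p ⟧ ≡ onA k r (λ s _ → ⟦ s₀ =ᶠ s ⟧ * 1) p
        pointwise (s , roleA _)   = sym (*-identityʳ _)
        pointwise (s , roleB _ _) = refl
        pointwise (s , roleC _ _) = refl
        pointwise (s , roleD _)   = refl

      ∣C∣ : countF (inC ∘ decode k r) ≡ nBlocks k r * k
      ∣C∣ = trans (countF-decode inC) (trans (∑ⱽ-cong k r pointwise) (trans (∑ⱽ-copyC k r s₀ (λ _ _ → 1))
              (trans (sum-cong-≗ {nBlocks k r} λ _ → sum-const k 1) (trans (sum-const (nBlocks k r) (k * 1))
                     (cong (nBlocks k r *_) (*-identityʳ k))))))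
        where
        pointwise : ∀ p → ⟦ inC p ⟧ ≡ onC k r (λ s _ _ → ⟦ s₀ =ᶠ s ⟧ * 1) p
        pointwise (s , roleA _)   = refl
        pointwise (s , roleB _ _) = refl
        pointwise (s , roleC _ _) = sym (*-identityʳ _)
        pointwise (s , roleD _)   = refl

      module AC = Biclique (Gkr k r U) (adj-sym U) (inA ∘ decode k r) (inC ∘ decode k r)
                    (disjoint ∘ decode k r) (λ v w → complete (decode k r v) (decode k r w))
                    (λ v w → A-independent (decode k r v) (decode k r w))
                    (λ v w → C-independent (decode k r v) (decode k r w))

    biclique : Subgraph (Gkr k r U)
    biclique = induced (Gkr k r U) (adj-sym U) (λ v → inA (decode k r v) ∨ inC (decode k r v))

    ∣V∣-biclique : ∣V∣ biclique ≡ k + nBlocks k r * k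
    ∣V∣-biclique = trans AC.countF-∪ (cong₂ _+_ ∣A∣ ∣C∣)

    ∣E∣-biclique : ∣E∣ biclique ≡ k * (nBlocks k r * k)
    ∣E∣-biclique = begin
      ∣E∣ biclique                          ≡⟨ ∣E∣≡edgeEnds/2 biclique ⟩
      edgeEnds biclique / 2                 ≡⟨ cong (_/ 2) AC.adjacentPairs-biclique ⟩
      2 * (countF (inA ∘ decode k r) * countF (inC ∘ decode k r)) / 2
                                            ≡⟨ cong (λ m → 2 * m / 2) (cong₂ _*_ ∣A∣ ∣C∣) ⟩
      2 * (k * (nBlocks k r * k)) / 2       ≡⟨ cong (_/ 2) (*-comm 2 (k * (nBlocks k r * k))) ⟩
      k * (nBlocks k r * k) * 2 / 2         ≡⟨ m*n/n≡m (k * (nBlocks k r * k)) 2 ⟩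
      k * (nBlocks k r * k)                 ∎
      where open ≡-Reasoning

-- Proper orientations of G(k,r)

module _ {k r : ℕ} (U : Fin r → Subset k) (D : Orientation (Gkr k r U)) where

  arcⱽ : Vertex k r → Vertex k r → Bool
  arcⱽ p q = arc D (vertex k r p) (vertex k r q)

  deg : Vertex k r → ℕ
  deg p = outdeg D (vertex k r p)

  deg≡∑ⱽ : ∀ p → deg p ≡ ∑ⱽ k r (λ q → ⟦ arcⱽ p q ⟧)
  deg≡∑ⱽ p = trans (outdeg≡sum D (vertex k r p)) (sum≡∑ⱽ k r (⟦_⟧ ∘ arc D (vertex k r p)))

  no-arc : ∀ p q → adjR k r U p q ≡ false → arcⱽ p q ≡ false
  no-arc p q ¬pq = arc-absent D (trans (adj-vertex U p q) ¬pq)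

  forced-arc : ∀ p q → adjR k r U p q ≡ true → arcⱽ q p ≡ false → arcⱽ p q ≡ true
  forced-arc p q pq = arc-forced D (trans (adj-vertex U p q) pq)

  deg-local : ∀ s ρ → isA ρ ≡ false → deg (s , ρ) ≡ ∑ᴿ k r (λ ρ′ → ⟦ arcⱽ (s , ρ) (s , ρ′) ⟧)
  deg-local s ρ ¬A = trans (deg≡∑ⱽ (s , ρ))
    (∑ⱽ-copy k r s λ s′ ρ′ s′≢s → cong ⟦_⟧ (no-arc (s , ρ) (s′ , ρ′) (adjR-other-copy U ρ ρ′ ¬A s′≢s)))

  deg-B : ∀ s S b → (∀ y → arcⱽ (s , roleA y) (s , roleB S b) ≡ false) → deg (s , roleB S b) ≡ ∣ subsetOf {k} S ∣
  deg-B s S b unreached = begin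
    deg (s , roleB S b)                                  ≡⟨ deg-local s (roleB S b) refl ⟩
    ∑ᴿ k r (λ ρ → ⟦ arcⱽ (s , roleB S b) (s , ρ) ⟧)      ≡⟨ ∑ᴿ-onlyA k r (λ ρ → ⟦ arcⱽ (s , roleB S b) (s , ρ) ⟧)
                                                             (λ S′ j → absent (roleB S′ j) refl)
                                                             (λ i t → absent (roleC i t) refl) (λ d → absent (roleD d) refl) ⟩
    ∑[ y < k ] ⟦ arcⱽ (s , roleB S b) (s , roleA y) ⟧   ≡⟨ sum-cong-≗ {k} arc≡ ⟩
    ∑[ y < k ] ⟦ lookup (subsetOf {k} S) y ⟧                ≡⟨ ∣p∣≡sum (subsetOf {k} S) ⟨
    ∣ subsetOf {k} S ∣                                       ∎
    where
    open ≡-Reasoning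
    absent : ∀ ρ → adjR k r U (s , roleB S b) (s , ρ) ≡ false → ⟦ arcⱽ (s , roleB S b) (s , ρ) ⟧ ≡ 0
    absent ρ ¬adj = cong ⟦_⟧ (no-arc (s , roleB S b) (s , ρ) ¬adj)
    BA-local : ∀ y → adjR k r U (s , roleB S b) (s , roleA y) ≡ lookup (subsetOf {k} S) y
    BA-local y rewrite =ᶠ-refl s = refl
    arc≡ : ∀ y → ⟦ arcⱽ (s , roleB S b) (s , roleA y) ⟧ ≡ ⟦ lookup (subsetOf {k} S) y ⟧
    arc≡ y with lookup (subsetOf {k} S) y in y∈S
    ... | true  = cong ⟦_⟧ (forced-arc (s , roleB S b) (s , roleA y) (trans (BA-local y) y∈S) (unreached y))
    ... | false = cong ⟦_⟧ (no-arc (s , roleB S b) (s , roleA y) (trans (BA-local y) y∈S))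

  deg-C : ∀ s i t → (∀ y → arcⱽ (s , roleA y) (s , roleC i t) ≡ false) →
          deg (s , roleC i t) ≡ k + ⟦ arcⱽ (s , roleC i t) (s , roleD i) ⟧
  deg-C s i t unreached =
    trans (deg-local s (roleC i t) refl)
          (cong₂ _+_ toA (cong₂ _+_ (sum-zero λ S → sum-zero λ j → absent (roleB S j) refl)
                         (cong₂ _+_ (sum-zero λ i′ → sum-zero λ t′ → absent (roleC i′ t′) refl) toD)))
    where
    c = (s , roleC i t)
    absent : ∀ ρ → adjR k r U c (s , ρ) ≡ false → ⟦ arcⱽ c (s , ρ) ⟧ ≡ 0
    absent ρ ¬adj = cong ⟦_⟧ (no-arc c (s , ρ) ¬adj)
    toA : ∑[ y < k ] ⟦ arcⱽ c (s , roleA y) ⟧ ≡ k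
    toA = trans (sum-cong-≗ {k} λ y → cong ⟦_⟧ (forced-arc c (s , roleA y) (=ᶠ-refl s) (unreached y)))
                (trans (sum-const k 1) (*-identityʳ k))
    toD : ∑[ d < nBlocks k r ] ⟦ arcⱽ c (s , roleD d) ⟧ ≡ ⟦ arcⱽ c (s , roleD i) ⟧
    toD = sum-supported-at i λ d d≢i →
      absent (roleD d) (trans (cong ((s =ᶠ s) ∧_) (=ᶠ-≢ (d≢i ∘ sym))) (∧-zeroʳ (s =ᶠ s)))

  deg-D : ∀ s i → (∀ t → arcⱽ (s , roleC i t) (s , roleD i) ≡ false) → deg (s , roleD i) ≡ k
  deg-D s i unreached = begin
    deg d                                             ≡⟨ deg-local s (roleD i) refl ⟩
    ∑ᴿ k r (λ ρ → ⟦ arcⱽ d (s , ρ) ⟧)                 ≡⟨ ∑ᴿ-onlyC k r (λ ρ → ⟦ arcⱽ d (s , ρ) ⟧)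
                                                           (λ a → absent (roleA a) refl) (λ S j → absent (roleB S j) refl)
                                                           (λ d′ → absent (roleD d′) refl) ⟩
    ∑[ i′ < nBlocks k r ] ∑[ t < k ] ⟦ arcⱽ d (s , roleC i′ t) ⟧
                                                      ≡⟨ sum-supported-at i (λ i′ i′≢i → sum-zero {k} λ t →
                                                             absent (roleC i′ t) (other-block {t = t} i′≢i)) ⟩
    ∑[ t < k ] ⟦ arcⱽ d (s , roleC i t) ⟧             ≡⟨ sum-cong-≗ {k} (λ t → cong ⟦_⟧
                                                             (forced-arc d (s , roleC i t) (own-block t) (unreached t))) ⟩
    ∑[ t < k ] 1                                      ≡⟨ trans (sum-const k 1) (*-identityʳ k) ⟩
    k                                                 ∎
    where
    open ≡-Reasoning
    d = (s , roleD i)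
    absent : ∀ ρ → adjR k r U d (s , ρ) ≡ false → ⟦ arcⱽ d (s , ρ) ⟧ ≡ 0
    absent ρ ¬adj = cong ⟦_⟧ (no-arc d (s , ρ) ¬adj)
    own-block : ∀ t → adjR k r U d (s , roleC i t) ≡ true
    own-block t rewrite =ᶠ-refl s = =ᶠ-refl i
    other-block : ∀ {i′ t} → i′ ≢ i → adjR k r U d (s , roleC i′ t) ≡ false
    other-block i′≢i rewrite =ᶠ-refl s = =ᶠ-≢ i′≢i

  module _ (proper : Proper D) (outdeg≤ : ∀ v → outdeg D v ≤ k + r) where

    private
      arcs-from-A≤ : ∀ s y → ∑ⱽ k r (λ q → ⟦ arcⱽ (s , roleA y) q ⟧) ≤ k + r
      arcs-from-A≤ s y = ≤-trans (≤-reflexive (sym (deg≡∑ⱽ (s , roleA y)))) (outdeg≤ (vertex k r (s , roleA y)))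

      arcs-into-B≤ : ∀ s S y → ∑[ b < sizeBS k r ] ⟦ arcⱽ (s , roleA y) (s , roleB S b) ⟧ ≤ k + r
      arcs-into-B≤ s S y = ≤-trans (∑ᴮ≤∑ⱽ k r (λ q → ⟦ arcⱽ (s , roleA y) q ⟧) s S) (arcs-from-A≤ s y)

      arcs-into-C≤ : ∀ s y → ∑[ i < nBlocks k r ] ∑[ t < k ] ⟦ arcⱽ (s , roleA y) (s , roleC i t) ⟧ ≤ k + r
      arcs-into-C≤ s y = ≤-trans (∑ᶜ≤∑ⱽ k r (λ q → ⟦ arcⱽ (s , roleA y) q ⟧) s) (arcs-from-A≤ s y)

      arc-to-D : Fin r → Fin (nBlocks k r) → Fin k → ℕ
      arc-to-D s i t = ⟦ arcⱽ (s , roleC i t) (s , roleD i) ⟧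

      unreached-B : ∀ s S → ∃ λ b → ∀ y → arcⱽ (s , roleA y) (s , roleB S b) ≡ false
      unreached-B s S with pigeonhole (λ y b → ⟦ arcⱽ (s , roleA y) (s , roleB S b) ⟧) (arcs-into-B≤ s S)
                                      (m<m+n (k * (k + r)) (s≤s z≤n))
      ... | b , none = b , λ y → ⟦⟧≡0⇒false (none y)

      unreached-C : ∀ s → 1 ≤ k → ∃ λ i → ∀ y t → arcⱽ (s , roleA y) (s , roleC i t) ≡ false
      unreached-C s 1≤k with pigeonhole (λ y i → ∑[ t < k ] ⟦ arcⱽ (s , roleA y) (s , roleC i t) ⟧) (arcs-into-C≤ s)
                                        (subst (k * (k + r) <_) (sym nBlocks≡) (m<m+n (k * (k + r)) 1≤k))
        where
        nBlocks≡ : nBlocks k r ≡ k * (k + r) + k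
        nBlocks≡ = trans (*-distribʳ-+ k (k + r) 1) (cong₂ _+_ (*-comm (k + r) k) (*-identityˡ k))
      ... | i , none = i , λ y t → ⟦⟧≡0⇒false (sum≡0⇒≡0 (λ t → ⟦ arcⱽ (s , roleA y) (s , roleC i t) ⟧) (none y) t)

    A-deg∉[1,k] : ∀ s x → 1 ≤ deg (s , roleA x) → deg (s , roleA x) ≤ k → ⊥
    A-deg∉[1,k] s x 1≤d d≤k with subset-containing x 1≤d d≤k
    ... | T , x∈T , ∣T∣≡d with subsetOf-onto T x∈T
    ...   | S , refl with unreached-B s S
    ...     | b , unreached =
      proper (vertex k r a) (vertex k r (s , roleB S b)) (trans (adj-vertex U a (s , roleB S b)) a∼b)
             (trans (sym ∣T∣≡d) (sym (deg-B s S b unreached)))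
      where
      a = (s , roleA x)
      a∼b : adjR k r U a (s , roleB S b) ≡ true
      a∼b rewrite =ᶠ-refl s = x∈T

    A-deg≢k+1 : ∀ s x → deg (s , roleA x) ≢ suc k
    A-deg≢k+1 s x d≡k+1 with unreached-C s (≤-trans (s≤s z≤n) (toℕ<n x))
    ... | i , unreached with sum (arc-to-D s i) ≟ 0
    ...   | yes none =
      proper (vertex k r (s , roleC i x)) (vertex k r (s , roleD i)) (trans (adj-vertex U (s , roleC i x) (s , roleD i)) c∼d)
             (trans (deg-C s i x (λ y → unreached y x))
                    (trans (cong (_+_ k) (sum≡0⇒≡0 (arc-to-D s i) none x)) (trans (+-identityʳ k) (sym (deg-D s i no-arc-to-d)))))
      where
      c∼d : adjR k r U (s , roleC i x) (s , roleD i) ≡ true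
      c∼d rewrite =ᶠ-refl s = =ᶠ-refl i
      no-arc-to-d : ∀ t → arcⱽ (s , roleC i t) (s , roleD i) ≡ false
      no-arc-to-d t = ⟦⟧≡0⇒false (sum≡0⇒≡0 (arc-to-D s i) none t)
    ...   | no some with sum≢0⇒∃≢0 (arc-to-D s i) some
    ...     | t , c→d≢0 =
      proper (vertex k r (s , roleA x)) (vertex k r (s , roleC i t)) (trans (adj-vertex U (s , roleA x) (s , roleC i t)) (=ᶠ-refl s))
             (trans d≡k+1 (sym (trans (deg-C s i t (λ y → unreached y t))
                                      (trans (cong (λ b → k + ⟦ b ⟧) (⟦⟧≢0⇒true c→d≢0)) (+-comm k 1)))))

-- Arcs inside ⋃ U_s

module _ {k r : ℕ} (U : Fin r → Subset k) where

  inU : Vertex k r → Bool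
  inU (s , roleA x)   = lookup (U s) x
  inU (_ , roleB _ _) = false
  inU (_ , roleC _ _) = false
  inU (_ , roleD _)   = false

  module _ {u : ℕ} (∣U∣≡u : ∀ s → ∣ U s ∣ ≡ u) where

    private
      pair : Vertex k r → Vertex k r → ℕ
      pair p q = ⟦ inU p ∧ (inU q ∧ adjR k r U p q) ⟧

      pair-A : ∀ s x q →
               pair (s , roleA x) q ≡ onA k r (λ s′ y → ⟦ lookup (U s) x ⟧ * (⟦ not (s =ᶠ s′) ⟧ * ⟦ lookup (U s′) y ⟧)) q
      pair-A s x (s′ , roleA y)   = triple (lookup (U s) x) (lookup (U s′) y) (not (s =ᶠ s′))
        where
        triple : ∀ a b c → ⟦ a ∧ (b ∧ (c ∧ (a ∧ b))) ⟧ ≡ ⟦ a ⟧ * (⟦ c ⟧ * ⟦ b ⟧)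
        triple false _     _     = refl
        triple true  false false = refl
        triple true  false true  = refl
        triple true  true  false = refl
        triple true  true  true  = refl
      pair-A s x (s′ , roleB _ _) = cong ⟦_⟧ (∧-zeroʳ (lookup (U s) x))
      pair-A s x (s′ , roleC _ _) = cong ⟦_⟧ (∧-zeroʳ (lookup (U s) x))
      pair-A s x (s′ , roleD _)   = cong ⟦_⟧ (∧-zeroʳ (lookup (U s) x))

      pairs-from : ∀ p → ∑ⱽ k r (pair p) ≡ onA k r (λ s x → ⟦ lookup (U s) x ⟧ * ((r ∸ 1) * u)) p
      pairs-from (s , roleA x)   = begin
        ∑ⱽ k r (pair (s , roleA x))
          ≡⟨ ∑ⱽ-cong k r (pair-A s x) ⟩
        ∑ⱽ k r (onA k r λ s′ y → ⟦ lookup (U s) x ⟧ * other s′ y)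
          ≡⟨ ∑ⱽ-onA k r _ ⟩
        ∑[ s′ < r ] ∑[ y < k ] (⟦ lookup (U s) x ⟧ * other s′ y)
          ≡⟨ trans (*-distribˡ-sum {r} ⟦ lookup (U s) x ⟧ (λ s′ → ∑[ y < k ] other s′ y))
                   (sum-cong-≗ {r} λ s′ → *-distribˡ-sum {k} ⟦ lookup (U s) x ⟧ (other s′)) ⟨
        ⟦ lookup (U s) x ⟧ * ∑[ s′ < r ] ∑[ y < k ] other s′ y
          ≡⟨ cong (⟦ lookup (U s) x ⟧ *_) (U-other-copies U ∣U∣≡u s) ⟩
        ⟦ lookup (U s) x ⟧ * ((r ∸ 1) * u)
          ∎
        where
        open ≡-Reasoning
        other : Fin r → Fin k → ℕ
        other s′ y = ⟦ not (s =ᶠ s′) ⟧ * ⟦ lookup (U s′) y ⟧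
      pairs-from (s , roleB _ _) = ∑ⱽ-zero k r
      pairs-from (s , roleC _ _) = ∑ⱽ-zero k r
      pairs-from (s , roleD _)   = ∑ⱽ-zero k r

    adjacentPairs-U : adjacentPairs (Gkr k r U) (inU ∘ decode k r) ≡ r * (u * ((r ∸ 1) * u))
    adjacentPairs-U = begin
      adjacentPairs (Gkr k r U) (inU ∘ decode k r)
        ≡⟨ sum-cong-≗ {r * N₁ k r} (λ v → sum-decode k r (pair (decode k r v))) ⟩
      ∑[ v < r * N₁ k r ] ∑ⱽ k r (pair (decode k r v))
        ≡⟨ sum-decode k r (∑ⱽ k r ∘ pair) ⟩
      ∑ⱽ k r (∑ⱽ k r ∘ pair)
        ≡⟨ ∑ⱽ-cong k r pairs-from ⟩
      ∑ⱽ k r (onA k r λ s x → ⟦ lookup (U s) x ⟧ * ((r ∸ 1) * u))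
        ≡⟨ ∑ⱽ-onA k r _ ⟩
      ∑[ s < r ] ∑[ x < k ] (⟦ lookup (U s) x ⟧ * ((r ∸ 1) * u))
        ≡⟨ sum-cong-≗ {r} (λ s → trans (sym (*-distribʳ-sum ((r ∸ 1) * u) (⟦_⟧ ∘ lookup (U s))))
                                       (cong (_* ((r ∸ 1) * u)) (U-size U ∣U∣≡u s))) ⟩
      ∑[ s < r ] (u * ((r ∸ 1) * u))
        ≡⟨ sum-const r _ ⟩
      r * (u * ((r ∸ 1) * u))
        ∎
      where open ≡-Reasoning

module _ {k t : ℕ} (U : Fin (suc t) → Subset k) (D : Orientation (Gkr k (suc t) U)) where

  outdeg-sum-U : ∑[ v < suc t * N₁ k (suc t) ] (⟦ inU U (decode k (suc t) v) ⟧ * outdeg D v)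
              ≡ ∑[ s < suc t ] ∑[ x < k ] (⟦ lookup (U s) x ⟧ * deg U D (s , roleA x))
  outdeg-sum-U = trans (sum≡∑ⱽ k (suc t) _)
                    (trans (∑ⱽ-cong k (suc t) pointwise)
                           (∑ⱽ-onA k (suc t) λ s x → ⟦ lookup (U s) x ⟧ * deg U D (s , roleA x)))
    where
    pointwise : ∀ p → ⟦ inU U (decode k (suc t) (vertex k (suc t) p)) ⟧ * deg U D p
                      ≡ onA k (suc t) (λ s x → ⟦ lookup (U s) x ⟧ * deg U D (s , roleA x)) p
    pointwise p rewrite decode-vertex k (suc t) p with p
    ... | (s , roleA x)   = refl
    ... | (s , roleB _ _) = refl
    ... | (s , roleC _ _) = refl
    ... | (s , roleD _)   = refl

  module _ {u : ℕ} (∣U∣≡u : ∀ s → ∣ U s ∣ ≡ u) (proper : Proper D) (outdeg≤ : ∀ v → outdeg D v ≤ k + suc t) where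

    private
      level : ℕ → ℕ
      level ℓ = ∑[ s < suc t ] ∑[ x < k ] (⟦ lookup (U s) x ⟧ * ⟦ deg U D (s , roleA x) ≡ᵇ ℓ ⟧)

      -- Vertices of ⋃ U_s with equal out-degree lie in a common U_s, since U_s and U_s′ are
      -- completely joined and D is proper.
      level≤u : ∀ ℓ → level ℓ ≤ u
      level≤u ℓ with level ℓ ≟ 0
      ... | yes ≡0 = ≤-trans (≤-reflexive ≡0) z≤n
      ... | no  ≢0 with sum≢0⇒∃≢0 _ ≢0
      ...   | s₀ , row≢0 with sum≢0⇒∃≢0 _ row≢0
      ...     | x₀ , term≢0 with ⟦⟧*⟦⟧≢0 _ _ term≢0
      ...       | x₀∈U , deg₀≡ℓ = begin
        level ℓ
          ≡⟨ sum-supported-at s₀ (λ s s≢s₀ → sum-zero λ x → other-copy s s≢s₀ x) ⟩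
        ∑[ x < k ] (⟦ lookup (U s₀) x ⟧ * ⟦ deg U D (s₀ , roleA x) ≡ᵇ ℓ ⟧)
          ≤⟨ sum-mono-≤ (λ x → ≤-trans (*-monoʳ-≤ ⟦ lookup (U s₀) x ⟧ (⟦⟧≤1 _))
                                       (≤-reflexive (*-identityʳ _))) ⟩
        ∑[ x < k ] ⟦ lookup (U s₀) x ⟧
          ≡⟨ U-size U ∣U∣≡u s₀ ⟩
        u
          ∎
        where
        open ≤-Reasoning
        other-copy : ∀ s → s ≢ s₀ → ∀ x → ⟦ lookup (U s) x ⟧ * ⟦ deg U D (s , roleA x) ≡ᵇ ℓ ⟧ ≡ 0
        other-copy s s≢s₀ x with lookup (U s) x in x∈U | deg U D (s , roleA x) ≡ᵇ ℓ in deg≡ℓ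
        ... | false | _     = refl
        ... | true  | false = refl
        ... | true  | true  = ⊥-elim (proper (vertex k (suc t) (s , roleA x)) (vertex k (suc t) (s₀ , roleA x₀))
                                              adjacent (trans (≡ᵇ-true⇒≡ deg≡ℓ) (sym (≡ᵇ-true⇒≡ deg₀≡ℓ))))
          where
          adjacent : adj (Gkr k (suc t) U) (vertex k (suc t) (s , roleA x)) (vertex k (suc t) (s₀ , roleA x₀)) ≡ true
          adjacent = trans (adj-vertex U (s , roleA x) (s₀ , roleA x₀))
                           (cong₂ (λ a b → not a ∧ b) (=ᶠ-≢ s≢s₀) (cong₂ _∧_ x∈U x₀∈U))

      level≡0 : ∀ ℓ → 1 ≤ ℓ → ℓ ≤ suc k → level ℓ ≡ 0
      level≡0 ℓ 1≤ℓ ℓ≤k+1 = sum-zero λ s → sum-zero λ x → term s x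
        where
        term : ∀ s x → ⟦ lookup (U s) x ⟧ * ⟦ deg U D (s , roleA x) ≡ᵇ ℓ ⟧ ≡ 0
        term s x with lookup (U s) x | deg U D (s , roleA x) ≡ᵇ ℓ in deg≡ℓ
        ... | false | _     = refl
        ... | true  | false = refl
        ... | true  | true with m≤n⇒m<n∨m≡n ℓ≤k+1
        ...   | inj₁ ℓ≤k  = ⊥-elim (A-deg∉[1,k] U D proper outdeg≤ s x
                                       (subst (1 ≤_) (sym (≡ᵇ-true⇒≡ deg≡ℓ)) 1≤ℓ)
                                       (subst (_≤ k) (sym (≡ᵇ-true⇒≡ deg≡ℓ)) (≤-pred ℓ≤k)))
        ...   | inj₂ ℓ≡k+1 = ⊥-elim (A-deg≢k+1 U D proper outdeg≤ s x (trans (≡ᵇ-true⇒≡ deg≡ℓ) ℓ≡k+1))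

      -- The levels toℕ ℓ, ℓ : Fin (2 + k + t), cover all out-degrees 0 … k + 1 + t.
      outdeg-sum-U≤ : ∑[ s < suc t ] ∑[ x < k ] (⟦ lookup (U s) x ⟧ * deg U D (s , roleA x)) ≤ u * ∑[ j < t ] (2 + k + toℕ j)
      outdeg-sum-U≤ = begin
        ∑[ s < suc t ] ∑[ x < k ] (⟦ lookup (U s) x ⟧ * deg U D (s , roleA x))
          ≡⟨ sum-cong-≗ {suc t} (λ s → sum-by-level (⟦_⟧ ∘ lookup (U s)) (λ x → deg U D (s , roleA x)) (deg< s)) ⟩
        ∑[ s < suc t ] ∑[ ℓ < N ] (toℕ ℓ * L s (toℕ ℓ))
          ≡⟨ ∑-comm {suc t} {N} (λ s ℓ → toℕ ℓ * L s (toℕ ℓ)) ⟩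
        ∑[ ℓ < N ] ∑[ s < suc t ] (toℕ ℓ * L s (toℕ ℓ))
          ≡⟨ sum-cong-≗ {N} (λ ℓ → *-distribˡ-sum {suc t} (toℕ ℓ) (λ s → L s (toℕ ℓ))) ⟨
        ∑[ ℓ < N ] (toℕ ℓ * level (toℕ ℓ))
          ≡⟨ sum-↑ (2 + k) weighted ⟩
        ∑[ i < 2 + k ] weighted (i ↑ˡ t) + ∑[ j < t ] weighted ((2 + k) ↑ʳ j)
          ≡⟨ cong (_+ ∑[ j < t ] weighted ((2 + k) ↑ʳ j))
                  (sum-zero {2 + k} λ i → subst (λ ℓ → ℓ * level ℓ ≡ 0) (sym (toℕ-↑ˡ i t)) (low (toℕ i) (toℕ<n i))) ⟩
        ∑[ j < t ] weighted ((2 + k) ↑ʳ j)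
          ≤⟨ sum-mono-≤ {t} (λ j → subst (λ ℓ → ℓ * level ℓ ≤ (2 + k + toℕ j) * u) (sym (toℕ-↑ʳ (2 + k) j))
                                         (*-monoʳ-≤ (2 + k + toℕ j) (level≤u (2 + k + toℕ j)))) ⟩
        ∑[ j < t ] ((2 + k + toℕ j) * u)
          ≡⟨ trans (*-comm u (∑[ j < t ] (2 + k + toℕ j))) (*-distribʳ-sum {t} u (λ j → 2 + k + toℕ j)) ⟨
        u * ∑[ j < t ] (2 + k + toℕ j)
          ∎
        where
        open ≤-Reasoning
        N = 2 + k + t
        weighted : Fin N → ℕ
        weighted ℓ = toℕ ℓ * level (toℕ ℓ)
        L : Fin (suc t) → ℕ → ℕ
        L s ℓ = ∑[ x < k ] (⟦ lookup (U s) x ⟧ * ⟦ deg U D (s , roleA x) ≡ᵇ ℓ ⟧)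
        deg< : ∀ s x → deg U D (s , roleA x) < N
        deg< s x = ≤-trans (s≤s (outdeg≤ (vertex k (suc t) (s , roleA x)))) (≤-reflexive (cong suc (+-suc k t)))
        low : ∀ ℓ → ℓ < 2 + k → ℓ * level ℓ ≡ 0
        low zero    _           = refl
        low (suc ℓ) (s≤s ℓ<k+1) = trans (cong (suc ℓ *_) (level≡0 (suc ℓ) (s≤s z≤n) ℓ<k+1)) (*-zeroʳ (suc ℓ))

    double-count-U : suc t * (u * (t * u)) + u * t ≤ u * (t * (2 * (2 + k) + t))
    double-count-U = begin
      suc t * (u * (t * u)) + u * t
        ≡⟨ cong (_+ u * t) (adjacentPairs-U U ∣U∣≡u) ⟨
      adjacentPairs (Gkr k (suc t) U) (inU U ∘ decode k (suc t)) + u * t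
        ≤⟨ +-monoˡ-≤ (u * t) (adjacentPairs≤2*∑outdeg D (inU U ∘ decode k (suc t))) ⟩
      2 * ∑[ v < suc t * N₁ k (suc t) ] (⟦ inU U (decode k (suc t) v) ⟧ * outdeg D v) + u * t
        ≡⟨ cong (λ m → 2 * m + u * t) outdeg-sum-U ⟩
      2 * ∑[ s < suc t ] ∑[ x < k ] (⟦ lookup (U s) x ⟧ * deg U D (s , roleA x)) + u * t
        ≤⟨ +-monoˡ-≤ (u * t) (*-monoʳ-≤ 2 outdeg-sum-U≤) ⟩
      2 * (u * S) + u * t
        ≡⟨ rearrange u S t ⟩
      u * (2 * S + t)
        ≡⟨ cong (u *_) (arithmetic-series (2 + k) t) ⟩
      u * (t * (2 * (2 + k) + t))
        ∎
      where
      open ≤-Reasoning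
      S = ∑[ j < t ] (2 + k + toℕ j)
      rearrange : ∀ u S t → 2 * (u * S) + u * t ≡ u * (2 * S + t)
      rearrange = solve-∀

-- With r = 2 + a, the hypothesis on k reads 2a² + 7a + 4 < 2k.
uSize-large : ∀ a k → 2 * (2 + a) * (2 + a) ∸ (2 + a) ∸ 2 < 2 * k → 2 * k + (2 + a) + 2 < (2 + a) * uSize k (2 + a)
uSize-large a k k-large = *-cancelˡ-< (suc a) _ _ (+-cancelʳ-< ((2 + a) * ρ) _ _ (begin-strict
    suc a * (K + (2 + a) + 2) + (2 + a) * ρ    ≡⟨ expand₁ a K ρ ⟩
    suc a * K + ((suc a * (a + 4)) + (2 + a) * ρ) <⟨ +-monoʳ-< (suc a * K) (≤-<-trans
                                                      (+-monoʳ-≤ (suc a * (a + 4)) (*-monoʳ-≤ (2 + a) ρ≤a)) small<K) ⟩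
    suc a * K + K                               ≡⟨ expand₂ a K ⟩
    (2 + a) * K                                 ≡⟨ cong ((2 + a) *_) (m≡m%n+[m/n]*n K (suc a)) ⟩
    (2 + a) * (ρ + u * suc a)                   ≡⟨ expand₃ a ρ u ⟩
    suc a * ((2 + a) * u) + (2 + a) * ρ         ∎))
  where
  open ≤-Reasoning
  K = 2 * k
  u = uSize k (2 + a)
  ρ = K % suc a
  ρ≤a : ρ ≤ a
  ρ≤a = ≤-pred (m%n<n K (suc a))
  small = suc a * (a + 4) + (2 + a) * a
  small<K : small < K
  small<K = subst (_< K) (trans (cong (λ m → m ∸ (2 + a) ∸ 2) (square a))
                          (trans (cong (_∸ 2) (m+n∸n≡m (small + 2) (2 + a))) (m+n∸n≡m small 2))) k-large
    where
    square : ∀ a → 2 * (2 + a) * (2 + a) ≡ suc a * (a + 4) + (2 + a) * a + 2 + (2 + a)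
    square = solve-∀
  expand₁ : ∀ a K ρ → suc a * (K + (2 + a) + 2) + (2 + a) * ρ ≡ suc a * K + ((suc a * (a + 4)) + (2 + a) * ρ)
  expand₁ = solve-∀
  expand₂ : ∀ a K → suc a * K + K ≡ (2 + a) * K
  expand₂ = solve-∀
  expand₃ : ∀ a ρ u → (2 + a) * (ρ + u * suc a) ≡ suc a * ((2 + a) * u) + (2 + a) * ρ
  expand₃ = solve-∀

too-many-arcs : ∀ a k u → 2 * k + (2 + a) + 2 < (2 + a) * u →
                (2 + a) * (u * (suc a * u)) + u * suc a ≤ u * (suc a * (2 * (2 + k) + suc a)) → ⊥
too-many-arcs a k zero    large _ rewrite *-zeroʳ (2 + a) = n≮0 large
too-many-arcs a k (suc v) large count = <-irrefl refl (begin-strict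
  c * X                                   <⟨ m<m+n (c * X) (s≤s z≤n) ⟩
  c * X + c                               ≡⟨ lhs a u ⟨
  (2 + a) * (u * (suc a * u)) + u * suc a ≤⟨ count ⟩
  u * (suc a * (2 * (2 + k) + suc a))     ≡⟨ rhs a k u ⟩
  c * suc (2 * k + (2 + a) + 2)           ≤⟨ *-monoʳ-≤ c large ⟩
  c * X                                   ∎)
  where
  open ≤-Reasoning
  u = suc v
  c = u * suc a
  X = (2 + a) * u
  lhs : ∀ a u → (2 + a) * (u * (suc a * u)) + u * suc a ≡ u * suc a * ((2 + a) * u) + u * suc a
  lhs = solve-∀
  rhs : ∀ a k u → u * (suc a * (2 * (2 + k) + suc a)) ≡ u * suc a * suc (2 * k + (2 + a) + 2)
  rhs = solve-∀

biclique-dense : ∀ k N → suc k ≤ N → 2 * k * (suc k + N * suc k) < 2 * (suc k * (N * suc k))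
biclique-dense k N k<N with m≤n⇒∃[o]m+o≡n k<N
... | e , refl = subst (2 * k * (suc k + N′ * suc k) <_) (sym (split k e)) (m<m+n _ (s≤s z≤n))
  where
  N′ = suc k + e
  split : ∀ k e → 2 * (suc k * ((suc k + e) * suc k)) ≡ 2 * k * (suc k + (suc k + e) * suc k) + 2 * suc k * suc e
  split = solve-∀

lemma2p1 : (k r : ℕ) → 3 ≤ r → 2 * r * r ∸ r ∸ 2 < 2 * k →
    (U : Fin r → Subset k) → (∀ s → ∣ U s ∣ ≡ uSize k r) →
    (∀ (m : ℚ) → IsMad (Gkr k r U) m → ceiling (m *ℚ ½) ≡ + k)
    × PONAtLeast (Gkr k r U) (k + r + 1)
lemma2p1 _       zero          ()
lemma2p1 _       (suc zero)    (s≤s ())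
lemma2p1 zero    (suc (suc a)) _ k-large = ⊥-elim (n≮0 k-large)
lemma2p1 (suc k) (suc (suc a)) _ k-large U ∣U∣≡u = mad , pon
  where
  u = uSize (suc k) (2 + a)
  U-small : suc a * u ≤ 2 * suc k
  U-small = subst (_≤ 2 * suc k) (*-comm u (suc a)) (m/n*n≤m (2 * suc k) (suc a))
  mad : ∀ m → IsMad (Gkr (suc k) (2 + a) U) m → ceiling (m *ℚ ½) ≡ + suc k
  mad m isMad = mad-ceiling k isMad (2∣E∣≤2k∣V∣ U ∣U∣≡u U-small) (biclique U zero)
    (subst NonZero (sym (∣V∣-biclique U zero)) _)
    (subst₂ (λ v e → 2 * k * v < 2 * e) (sym (∣V∣-biclique U zero)) (sym (∣E∣-biclique U zero))
            (biclique-dense k (nBlocks (suc k) (2 + a)) (m≤n*m (suc k) (suc k + (2 + a) + 1))))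
  pon : PONAtLeast (Gkr (suc k) (2 + a) U) (suc k + (2 + a) + 1)
  pon D proper with suc k + (2 + a) + 1 ≤? Δ⁺ D
  ... | yes enough = enough
  ... | no  few    = ⊥-elim (too-many-arcs a (suc k) u (uSize-large a (suc k) k-large)
                                           (double-count-U U D ∣U∣≡u proper outdeg≤))
    where
    outdeg≤ : ∀ v → outdeg D v ≤ suc k + (2 + a)
    outdeg≤ v = ≤-trans (outdeg≤Δ⁺ D v) (≤-pred (≤-trans (≰⇒> few) (≤-reflexive (+-comm _ 1))))
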